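{- The $\mathbb{Z}$-linear map $F:\mathcal{M}at\to\mathcal{QS}ym$ defined on basis elements by $[M]\mapsto F(M,\mathbf{x})$ is a morphism of Hopf algebras.
   Context: For a matroid $M$ on finite ground set $E$ with bases $\mathcal{B}(M)$, and $f:E\to\mathbb{P}=\{1,2,\ldots\}$, call $f$ $M$-generic if the minimum of $f(B)=\sum_{e\in B}f(e)$ over bases $B$ is attained by a unique base, and set $F(M,\mathbf{x})=\sum_{f\ M\text{ -generic}}\prod_{e\in E}x_{f(e)}$ (for $E=\emptyset$ this is $1$). $\mathcal{M}at$ is the free $\mathbb{Z}$-module with basis $[M]$ indexed by isomorphism classes of matroids, graded by $|E|$, with product $[M_1]\cdot[M_2]=[M_1\oplus M_2]$ (direct sum), unit the class of the empty matroid, counit the projection to degree $0$, and coproduct $\Delta[M]=\sum_{A\subseteq E}[M|_A]\otimes[M/A]$, where $M|_A$ is the restriction to $A$ and $M/A$ the contraction by $A$; this is a graded connected Hopf algebra. $\mathcal{QS}ym$ is the Hopf algebra over $\mathbb{Z}$ of quasisymmetric functions in $x_1,x_2,\ldots$ (bounded-degree power series in which, for each composition $(\alpha_1,\ldots,\alpha_k)$, the coefficient of $x_{i_1}^{\alpha_1}\cdots x_{i_k}^{\alpha_k}$ is independent of $i_1<\cdots<i_k$), graded by degree, with the usual product of power series. Its coproduct is defined as follows: a quasisymmetric $g(\mathbf{x})$ determines a unique quasisymmetric $g(\mathbf{x},\mathbf{y})$ in the linearly ordered variables $x_1<x_2<\cdots<y_1<y_2<\cdots$ with $g(\mathbf{x},\mathbf{0})=g(\mathbf{x})$;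 writing uniquely $g(\mathbf{x},\mathbf{y})=\sum_i g_i(\mathbf{x})h_i(\mathbf{y})$ with $g_i,h_i$ quasisymmetric, set $\Delta g=\sum_i g_i\otimes h_i$. -}

module Defs where

open import Data.Bool using (Bool; true; false; _∧_; _∨_; not; if_then_else_; T)
open import Data.Nat using (ℕ; zero; suc; _+_; _*_; _∸_; _<ᵇ_; _≡ᵇ_)
open import Data.Fin using (Fin; toℕ)
open import Data.Fin.Subset using (Subset; _∈_; _∉_; _∪_; _-_; ⁅_⁆; ∁)
open import Data.Fin.Permutation using (Permutation′; _⟨$⟩ʳ_)
open import Data.List using (List; []; _∷_; concatMap; map; length; filterᵇ; allFin; upTo)
open import Data.Bool.ListAction using (all; any)
open import Data.Nat.ListAction using (sum)
import Data.List as List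
open import Data.Vec using (Vec; []; _∷_; take; drop; zipWith; tabulate; lookup; fromList; toList; foldr)
import Data.Vec as Vec
open import Data.Vec.Properties using (≡-dec)
open import Data.Bool.Properties renaming (_≟_ to _≟B_)
open import Data.Fin.Properties renaming (_≟_ to _≟F_)
open import Data.Product using (Σ; ∃; ∃-syntax; _×_; _,_)
open import Relation.Nullary.Decidable using (⌊_⌋)
open import Relation.Binary.PropositionalEquality using (_≡_)

allSubsets : (n : ℕ) → List (Subset n)
allSubsets zero    = [] ∷ []
allSubsets (suc n) = concatMap (λ X → (true ∷ X) ∷ (false ∷ X) ∷ []) (allSubsets n)

allFuns : (n k : ℕ) → List (Vec (Fin k) n)
allFuns zero    k = [] ∷ []
allFuns (suc n) k = concatMap (λ f → map (λ v → v ∷ f) (allFin k)) (allFuns n k)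

_==ˢ_ : {n : ℕ} → Subset n → Subset n → Bool
X ==ˢ Y = ⌊ ≡-dec _≟B_ X Y ⌋

_⊆ᵇ_ : {n : ℕ} → Subset n → Subset n → Bool
[]      ⊆ᵇ []      = true
(x ∷ X) ⊆ᵇ (y ∷ Y) = (not x ∨ y) ∧ (X ⊆ᵇ Y)

BaseFamily : ℕ → Set
BaseFamily n = Subset n → Bool

record Matroid (n : ℕ) : Set where
  field
    isBase   : BaseFamily n
    nonempty : ∃[ B ] T (isBase B)
    exchange : ∀ B₁ B₂ → T (isBase B₁) → T (isBase B₂) →
               ∀ x → x ∈ B₁ → x ∉ B₂ →
               ∃[ y ] (y ∈ B₂ × y ∉ B₁ × T (isBase ((B₁ - x) ∪ ⁅ y ⁆)))
open Matroid public

isIndep : {n : ℕ} → BaseFamily n → Subset n → Bool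
isIndep {n} 𝓑 I = any (λ B → 𝓑 B ∧ (I ⊆ᵇ B)) (allSubsets n)

size : {n : ℕ} → Subset n → ℕ
size []          = 0
size (true ∷ A)  = suc (size A)
size (false ∷ A) = size A

-- the order-preserving identification of Fin (size A) with A ⊆ Fin n,
-- applied to subsets: a subset of A (indexed by Fin (size A)) as a subset of Fin n
lift : {n : ℕ} (A : Subset n) → Subset (size A) → Subset n
lift []          []      = []
lift (true ∷ A)  (b ∷ X) = b ∷ lift A X
lift (false ∷ A) X       = false ∷ lift A X

-- bases of the restriction M|A (ground set A ≅ Fin (size A)):
-- the inclusion-maximal independent sets of M contained in A
restrictBases : {n : ℕ} → BaseFamily n → (A : Subset n) → BaseFamily (size A)
restrictBases 𝓑 A X =
  isIndep 𝓑 (lift A X) ∧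
  not (any (λ Y → (X ⊆ᵇ Y) ∧ not (X ==ˢ Y) ∧ isIndep 𝓑 (lift A Y))
           (allSubsets (size A)))

-- bases of the contraction M/A (ground set E∖A ≅ Fin (size (∁ A))):
-- the sets X ⊆ E∖A such that X ∪ B_A is a base of M for a base B_A of M|A
contractBases : {n : ℕ} → BaseFamily n → (A : Subset n) → BaseFamily (size (∁ A))
contractBases 𝓑 A X =
  any (λ Y → restrictBases 𝓑 A Y ∧ 𝓑 (lift (∁ A) X ∪ lift A Y))
      (allSubsets (size A))

-- bases of the direct sum M₁ ⊕ M₂ on Fin (n₁ + n₂) = Fin n₁ ⊔ Fin n₂
directSumBases : {n₁ n₂ : ℕ} → BaseFamily n₁ → BaseFamily n₂ → BaseFamily (n₁ + n₂)
directSumBases {n₁} 𝓑₁ 𝓑₂ B = 𝓑₁ (take n₁ B) ∧ 𝓑₂ (drop n₁ B)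

emptyBases : BaseFamily 0
emptyBases [] = true

-- M' is the image of M under the permutation σ of the ground set:
-- B is a base of M' iff σ⁻¹(B) is a base of M
IsoVia : {n : ℕ} → Permutation′ n → BaseFamily n → BaseFamily n → Set
IsoVia {n} σ 𝓑 𝓑' = ∀ B → 𝓑' B ≡ 𝓑 (tabulate (λ i → lookup B (σ ⟨$⟩ʳ i)))

-- A function f : E → {1,…,k} is represented by f : Vec (Fin k) n,
-- element e having value toℕ (f e) + 1.

weight : {n k : ℕ} → Vec (Fin k) n → Subset n → ℕ
weight f B = Vec.sum (zipWith (λ v b → if b then suc (toℕ v) else 0) f B)

isGeneric : {n k : ℕ} → BaseFamily n → Vec (Fin k) n → Bool
isGeneric {n} 𝓑 f =
  any (λ B → 𝓑 B ∧
             all (λ B' → not (𝓑 B') ∨ (B' ==ˢ B) ∨ (weight f B <ᵇ weight f B'))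
                 (allSubsets n))
      (allSubsets n)

fibre : {n k : ℕ} → Vec (Fin k) n → Fin k → ℕ
fibre f i = Vec.count (λ v → v ≟F i) f

-- Coefficient of the monomial x₁^{a₁} ⋯ x_k^{a_k} in a power series in
-- x₁, x₂, … ; a power series in infinitely many variables is determined by
-- these coefficients for all k.
-- coeffF 𝓑 k a = coefficient of x₁^{a₁}⋯x_k^{a_k} in F(M, x)
--             = #{ generic f : E → {1..k} with |f⁻¹(i)| = aᵢ for all i }.
coeffF : {n : ℕ} → BaseFamily n → (k : ℕ) → Vec ℕ k → ℕ
coeffF {n} 𝓑 k a =
  length (filterᵇ (λ f → isGeneric 𝓑 f ∧
                          all (λ i → fibre f i ≡ᵇ lookup a i) (allFin k))
                  (allFuns n k))

below : {k : ℕ} → Vec ℕ k → List (Vec ℕ k)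
below []      = [] ∷ []
below (a ∷ as) = concatMap (λ bs → map (λ b → b ∷ bs) (upTo (suc a))) (below as)

-- coefficient of x^a in the product of two power series given by
-- their coefficient functions g, h (in the variables x₁..x_k)
productCoeff : {k : ℕ} → (Vec ℕ k → ℕ) → (Vec ℕ k → ℕ) → Vec ℕ k → ℕ
productCoeff g h a = sum (map (λ b → g b * h (zipWith _∸_ a b)) (below a))

flatten : {k : ℕ} → Vec ℕ k → List ℕ
flatten a = List.filterᵇ (λ m → not (m ≡ᵇ 0)) (toList a)

-- the coefficient of 1 (degree-0 part)
allZero : {k : ℕ} → Vec ℕ k → Bool
allZero a = all (λ m → m ≡ᵇ 0) (toList a)

{-# OPTIONS --safe #-}
module Submission where

-- A coefficient of F(M, x) counts the maps f : E → {1,…,k} with prescribed fibre sizes for which the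
-- weight f(B) has a unique minimising base B; every claim is proved by a bijection between such maps.
-- In a matroid a base is the unique cheapest one iff every single exchange B - x + y that is again a
-- base is strictly more expensive (induction on |B′ ∖ B|, using the dual exchange property), so
-- genericity only depends on the relative order of the values of f.  This gives quasisymmetry (compress
-- the values of f to 1,…,ℓ) and invariance under isomorphism.  If A = f⁻¹{1,…,k} carries the small
-- values, a cheapest base meets A in a base of M|A and its part outside A is a base of M/A, and the
-- weights of the two parts add up; hence f is generic for M iff f|A is generic for M|A and f − k on
-- E ∖ A is generic for M/A, which is the coproduct formula.  The product formula is the same additivity
-- for the direct sum M₁ ⊕ M₂.

open import Defs

import Data.Nat.Properties as ℕ
open import Algebra.Properties.CommutativeSemigroup ℕ.+-commutativeSemigroup
  using (x∙yz≈y∙xz; xy∙z≈xz∙y; interchange)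
open import Algebra.Properties.CommutativeMonoid.Sum ℕ.+-0-commutativeMonoid
  using (sum-permute; sum-cong-≗) renaming (sum to ∑)
open import Data.Bool using (Bool; true; false; T; _∧_; _∨_; not; if_then_else_)
open import Data.Bool.ListAction using (all; any)
open import Data.Bool.Properties using (T-∧; T-≡; ⇔→≡) renaming (_≟_ to _≟ᵇ_)
open import Data.Empty using (⊥-elim)
open import Data.Fin using (Fin; zero; suc; toℕ; _↑ˡ_; _↑ʳ_; splitAt; join)
open import Data.Fin.Permutation using (Permutation′; _⟨$⟩ʳ_; _⟨$⟩ˡ_; flip; inverseˡ; inverseʳ)
open import Data.Fin.Properties
  using (suc-injective; toℕ-↑ˡ; toℕ-↑ʳ; toℕ<n; ↑ˡ-injective; ↑ʳ-injective;
         splitAt-↑ˡ; splitAt-↑ʳ; splitAt⁻¹-↑ˡ; splitAt⁻¹-↑ʳ; join-splitAt)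
  renaming (_≟_ to _≟ᶠ_)
open import Data.Fin.Subset using (Subset; _∈_; _∉_; _⊆_; _⊂_; _∪_; _∩_; _─_; _-_; ⁅_⁆; ⊥; ∁; ∣_∣; Nonempty; Empty)
open import Data.Fin.Subset.Properties
open import Data.List as List
  using (List; []; _∷_; length; map; concatMap; filter; filterᵇ; cartesianProduct; allFin; upTo)
open import Data.List.Extrema.Nat using (argmin; argmin-sel; f[argmin]≤f[xs])
open import Data.List.Membership.Propositional using (lose) renaming (_∈_ to _∈ₗ_; _∉_ to _∉ₗ_)
open import Data.List.Membership.Propositional.Properties
  using (∈-map⁺; ∈-map⁻; ∈-++⁺ˡ; ∈-++⁺ʳ; ∈-++⁻; ∈-filter⁺; ∈-filter⁻; ∈-allFin; ∈-upTo⁺; ∈-upTo⁻;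
         ∈-cartesianProduct⁺; ∈-cartesianProduct⁻)
open import Data.List.Membership.Propositional.Properties.WithK using (unique∧set⇒bag)
open import Data.List.Properties using (length-++; length-map; map-cong; map-cong-local)
open import Data.List.Relation.Binary.BagAndSetEquality using (∼bag⇒↭)
open import Data.List.Relation.Binary.Permutation.Propositional.Properties using (↭-length)
open import Data.List.Relation.Unary.All using ([]; _∷_)
import Data.List.Relation.Unary.All as All
open import Data.List.Relation.Unary.All.Properties using (all⁺; all⁻)
open import Data.List.Relation.Unary.AllPairs using ([]; _∷_)
open import Data.List.Relation.Unary.Any using (here; there; satisfied)
open import Data.List.Relation.Unary.Any.Properties using (any⁺; any⁻)
open import Data.List.Relation.Unary.Unique.Propositional using (Unique)
import Data.List.Relation.Unary.Unique.Propositional.Properties as Unique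
open import Data.Nat using (ℕ; zero; suc; _+_; _*_; _∸_; _≤_; _<_; z≤n; s≤s; _<ᵇ_; _≡ᵇ_)
open import Data.Nat.Induction using (<-wellFounded)
open import Data.Nat.ListAction using (sum)
open import Data.Product as Product using (∃; ∃₂; _×_; _,_; proj₁; proj₂; uncurry)
open import Data.Sum using (_⊎_; inj₁; inj₂; [_,_]′)
open import Data.Vec as Vec
  using (Vec; []; _∷_; head; tail; lookup; replicate; tabulate; take; drop; _++_; zipWith; fromList; here; there)
open import Data.Vec.Properties
  using (∷-injective; ∷-injectiveˡ; ≡-dec; lookup-map; lookup-replicate; lookup∘tabulate; tabulate∘lookup;
         tabulate-cong; tabulate-∘; take++drop≡id; ++-injective; ++-injectiveˡ; ++-injectiveʳ; map-++;
         lookup-zipWith; lookup-++ˡ; lookup-++ʳ)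
open import Function using (_∘_; id; const; Injective)
open import Function.Bundles using (_⇔_; mk⇔; Equivalence)
open import Function.Properties.Equivalence using () renaming (sym to ⇔-sym; trans to ⇔-trans)
open import Induction.WellFounded using (Acc; acc)
open import Relation.Binary.Definitions using (DecidableEquality)
open import Relation.Binary.PropositionalEquality
open import Relation.Nullary using (¬_; Dec; yes; no; contradiction)
open import Relation.Nullary.Decidable using (T?; ⌊_⌋; toWitness; fromWitness)
open import Relation.Unary using (Decidable)

private
  variable
    S U : Set
    n k n₁ n₂ : ℕ
    i x y : Fin n
    A B B′ X X′ Y Y′ : Subset n

length-unique-≡ : {xs ys : List S} → Unique xs → Unique ys →
                  (∀ {z} → z ∈ₗ xs ⇔ z ∈ₗ ys) → length xs ≡ length ys
length-unique-≡ u v xs≈ys = ↭-length (∼bag⇒↭ (unique∧set⇒bag u v xs≈ys))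

∈-filterᵇ⇔ : (p : S → Bool) {xs : List S} → (∀ x → x ∈ₗ xs) → ∀ {x} → x ∈ₗ filterᵇ p xs ⇔ T (p x)
∈-filterᵇ⇔ p {xs} complete = mk⇔ (proj₂ ∘ ∈-filter⁻ (T? ∘ p) {xs = xs}) (∈-filter⁺ (T? ∘ p) (complete _))

length-filterᵇ-image : (p : S → Bool) {xs : List S} {zs : List U} (φ : U → S) →
  Unique xs → (∀ x → x ∈ₗ xs) → Unique zs → Injective _≡_ _≡_ φ →
  (∀ x → T (p x) ⇔ (∃ λ z → z ∈ₗ zs × φ z ≡ x)) →
  length (filterᵇ p xs) ≡ length zs
length-filterᵇ-image p {xs} {zs} φ uxs complete uzs φ-inj image = begin
  length (filterᵇ p xs) ≡⟨ length-unique-≡ (Unique.filter⁺ (T? ∘ p) uxs) (Unique.map⁺ φ-inj uzs) same ⟩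
  length (map φ zs)     ≡⟨ length-map φ zs ⟩
  length zs             ∎
  where
  open ≡-Reasoning
  same : ∀ {x} → x ∈ₗ filterᵇ p xs ⇔ x ∈ₗ map φ zs
  same {x} = mk⇔
    (λ x∈ → let (z , z∈ , φz≡x) = Equivalence.to (image x) (Equivalence.to (∈-filterᵇ⇔ p complete) x∈)
            in subst (_∈ₗ map φ zs) φz≡x (∈-map⁺ φ z∈))
    (λ x∈ → let (z , z∈ , x≡φz) = ∈-map⁻ φ x∈
            in Equivalence.from (∈-filterᵇ⇔ p complete) (Equivalence.from (image x) (z , z∈ , sym x≡φz)))

length-cartesianProduct : (xs : List S) (ys : List U) → length (cartesianProduct xs ys) ≡ length xs * length ys
length-cartesianProduct []       ys = refl
length-cartesianProduct (x ∷ xs) ys = begin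
  length (map (x ,_) ys List.++ cartesianProduct xs ys)     ≡⟨ length-++ (map (x ,_) ys) ⟩
  length (map (x ,_) ys) + length (cartesianProduct xs ys)
    ≡⟨ cong₂ _+_ (length-map (x ,_) ys) (length-cartesianProduct xs ys) ⟩
  length ys + length xs * length ys                      ∎
  where open ≡-Reasoning

χ : Bool → ℕ
χ b = if b then 1 else 0

length-filterᵇ-∷ : (p : S → Bool) (x : S) (xs : List S) →
                   length (filterᵇ p (x ∷ xs)) ≡ χ (p x) + length (filterᵇ p xs)
length-filterᵇ-∷ p x xs with p x
... | true  = refl
... | false = refl

sum-map-+ : (f g : S → ℕ) (xs : List S) → sum (map (λ x → f x + g x) xs) ≡ sum (map f xs) + sum (map g xs)
sum-map-+ f g []       = refl
sum-map-+ f g (x ∷ xs) = begin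
  f x + g x + sum (map (λ x → f x + g x) xs)        ≡⟨ cong (f x + g x +_) (sum-map-+ f g xs) ⟩
  f x + g x + (sum (map f xs) + sum (map g xs))      ≡⟨ interchange (f x) (g x) _ _ ⟩
  f x + sum (map f xs) + (g x + sum (map g xs))      ∎
  where open ≡-Reasoning

sum-map-zero : (f : S → ℕ) (xs : List S) → (∀ x → x ∈ₗ xs → f x ≡ 0) → sum (map f xs) ≡ 0
sum-map-zero f []       _    = refl
sum-map-zero f (x ∷ xs) f≡0 = cong₂ _+_ (f≡0 x (here refl)) (sum-map-zero f xs (λ y y∈ → f≡0 y (there y∈)))

module _ {K : Set} (_≟_ : DecidableEquality K) where

  private
    χ≟≡0 : ∀ {c d} → c ≢ d → χ ⌊ c ≟ d ⌋ ≡ 0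
    χ≟≡0 {c} {d} c≢d with c ≟ d
    ... | yes c≡d = contradiction c≡d c≢d
    ... | no  _   = refl

    sum-χ≟-∉ : ∀ {c} (ks : List K) → c ∉ₗ ks → sum (map (λ d → χ ⌊ c ≟ d ⌋) ks) ≡ 0
    sum-χ≟-∉ ks c∉ = sum-map-zero _ ks (λ d d∈ → χ≟≡0 (λ { refl → c∉ d∈ }))

    sum-χ≟-∈ : ∀ {c} {ks : List K} → Unique ks → c ∈ₗ ks → sum (map (λ d → χ ⌊ c ≟ d ⌋) ks) ≡ 1
    sum-χ≟-∈ {c} {d ∷ ks} (d∉ ∷ uks) (here refl) with c ≟ c
    ... | yes _  = cong suc (sum-χ≟-∉ ks (λ c∈ → All.lookup d∉ c∈ refl))
    ... | no c≢c = contradiction refl c≢c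
    sum-χ≟-∈ {c} {d ∷ ks} (d∉ ∷ uks) (there c∈) =
      cong₂ _+_ (χ≟≡0 (λ c≡d → All.lookup d∉ c∈ (sym c≡d))) (sum-χ≟-∈ uks c∈)

  module _ (p : S → Bool) (κ : S → K) (ks : List K) (uks : Unique ks) (κ∈ : ∀ x → T (p x) → κ x ∈ₗ ks) where

    private
      count : K → List S → ℕ
      count c xs = length (filterᵇ (λ x → p x ∧ ⌊ κ x ≟ c ⌋) xs)

      head-term : ∀ x → sum (map (λ c → χ (p x ∧ ⌊ κ x ≟ c ⌋)) ks) ≡ χ (p x)
      head-term x with p x in px
      ... | true  = sum-χ≟-∈ uks (κ∈ x (subst T (sym px) _))
      ... | false = sum-map-zero _ ks (λ _ _ → refl)

    length-filterᵇ-partition : ∀ xs →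
      length (filterᵇ p xs) ≡ sum (map (λ c → length (filterᵇ (λ x → p x ∧ ⌊ κ x ≟ c ⌋) xs)) ks)
    length-filterᵇ-partition []       = sym (sum-map-zero _ ks (λ _ _ → refl))
    length-filterᵇ-partition (x ∷ xs) = begin
      length (filterᵇ p (x ∷ xs))
        ≡⟨ length-filterᵇ-∷ p x xs ⟩
      χ (p x) + length (filterᵇ p xs)
        ≡⟨ cong₂ _+_ (sym (head-term x)) (length-filterᵇ-partition xs) ⟩
      sum (map (λ c → χ (p x ∧ ⌊ κ x ≟ c ⌋)) ks) + sum (map (λ c → count c xs) ks)
        ≡⟨ sum-map-+ _ _ ks ⟨
      sum (map (λ c → χ (p x ∧ ⌊ κ x ≟ c ⌋) + count c xs) ks)
        ≡⟨ cong sum (map-cong (λ c → length-filterᵇ-∷ _ x xs) ks) ⟨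
      sum (map (λ c → count c (x ∷ xs)) ks)
        ∎
      where open ≡-Reasoning

cheapest : (c : S → ℕ) {P : S → Set} → Decidable P → (xs : List S) → (∀ x → x ∈ₗ xs) →
           ∃ P → ∃ λ m → P m × (∀ x → P x → c m ≤ c x)
cheapest c {P} P? xs complete (x₀ , Px₀) = m , Pm , minimal
  where
  candidates : List _
  candidates = filter P? xs
  m = argmin c x₀ candidates
  Pm : P m
  Pm with argmin-sel c x₀ candidates
  ... | inj₁ m≡x₀ = subst P (sym m≡x₀) Px₀
  ... | inj₂ m∈   = proj₂ (∈-filter⁻ P? {xs = xs} m∈)
  minimal : ∀ x → P x → c m ≤ c x
  minimal x Px = All.lookup (f[argmin]≤f[xs] {f = c} x₀ candidates) (∈-filter⁺ P? (complete x) Px)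

-- allSubsets (suc n), allFuns (suc n) k and below (a ∷ as) unfold to consAll (true ∷ false ∷ []) (allSubsets n),
-- consAll (allFin k) (allFuns n k) and consAll (upTo (suc a)) (below as).
consAll : ∀ {n} → List S → List (Vec S n) → List (Vec S (suc n))
consAll hs = concatMap (λ t → map (_∷ t) hs)

∈-consAll⁺ : ∀ {n} {hs : List S} {ts : List (Vec S n)} {h t} → h ∈ₗ hs → t ∈ₗ ts → (h ∷ t) ∈ₗ consAll hs ts
∈-consAll⁺ {hs = hs} {t ∷ ts} h∈ (here refl) = ∈-++⁺ˡ (∈-map⁺ (_∷ t) h∈)
∈-consAll⁺ {hs = hs} {u ∷ ts} h∈ (there t∈) = ∈-++⁺ʳ (map (_∷ u) hs) (∈-consAll⁺ h∈ t∈)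

∈-consAll⁻ : ∀ {n} (hs : List S) (ts : List (Vec S n)) {v} → v ∈ₗ consAll hs ts → head v ∈ₗ hs × tail v ∈ₗ ts
∈-consAll⁻ hs (t ∷ ts) v∈ with ∈-++⁻ (map (_∷ t) hs) v∈
... | inj₁ v∈hs∷t with ∈-map⁻ (_∷ t) v∈hs∷t
...   | h , h∈ , refl = h∈ , here refl
∈-consAll⁻ hs (t ∷ ts) v∈ | inj₂ v∈rest = Product.map₂ there (∈-consAll⁻ hs ts v∈rest)

consAll⁺ : ∀ {n} {hs : List S} {ts : List (Vec S n)} → Unique hs → Unique ts → Unique (consAll hs ts)
consAll⁺ {ts = []}     uhs []           = []
consAll⁺ {hs = hs} {ts = t ∷ ts} uhs (t∉ ∷ uts) =
  Unique.++⁺ (Unique.map⁺ ∷-injectiveˡ uhs) (consAll⁺ uhs uts) disjoint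
  where
  disjoint : ∀ {v} → ¬ (v ∈ₗ map (_∷ t) hs × v ∈ₗ consAll hs ts)
  disjoint (v∈ , v∈rest) with ∈-map⁻ (_∷ t) v∈
  ... | h , _ , refl = All.lookup t∉ (proj₂ (∈-consAll⁻ hs ts v∈rest)) refl

allSubsets-complete : ∀ {n} (X : Vec Bool n) → X ∈ₗ allSubsets n
allSubsets-complete []          = here refl
allSubsets-complete (true ∷ X)  = ∈-consAll⁺ (here refl) (allSubsets-complete X)
allSubsets-complete (false ∷ X) = ∈-consAll⁺ (there (here refl)) (allSubsets-complete X)

allSubsets-unique : ∀ n → Unique (allSubsets n)
allSubsets-unique zero    = [] ∷ []
allSubsets-unique (suc n) = consAll⁺ (((λ ()) ∷ []) ∷ [] ∷ []) (allSubsets-unique n)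

allFuns-complete : ∀ {n k} (f : Vec (Fin k) n) → f ∈ₗ allFuns n k
allFuns-complete []      = here refl
allFuns-complete (v ∷ f) = ∈-consAll⁺ (∈-allFin v) (allFuns-complete f)

allFuns-unique : ∀ n k → Unique (allFuns n k)
allFuns-unique zero    k = [] ∷ []
allFuns-unique (suc n) k = consAll⁺ (Unique.allFin⁺ k) (allFuns-unique n k)

∈-below⁺ : ∀ {k} {a b : Vec ℕ k} → (∀ i → lookup b i ≤ lookup a i) → b ∈ₗ below a
∈-below⁺ {a = []}    {[]}    _    = here refl
∈-below⁺ {a = x ∷ a} {y ∷ b} b≤a = ∈-consAll⁺ (∈-upTo⁺ (s≤s (b≤a zero))) (∈-below⁺ {a = a} (b≤a ∘ suc))

∈-below⁻ : ∀ {k} (a : Vec ℕ k) {b} → b ∈ₗ below a → ∀ i → lookup b i ≤ lookup a i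
∈-below⁻ (x ∷ a) {y ∷ b} b∈ zero    = ℕ.≤-pred (∈-upTo⁻ (proj₁ (∈-consAll⁻ (upTo (suc x)) (below a) b∈)))
∈-below⁻ (x ∷ a) {y ∷ b} b∈ (suc i) = ∈-below⁻ a (proj₂ (∈-consAll⁻ (upTo (suc x)) (below a) b∈)) i

below-unique : ∀ {k} (a : Vec ℕ k) → Unique (below a)
below-unique []      = [] ∷ []
below-unique (x ∷ a) = consAll⁺ (Unique.upTo⁺ (suc x)) (below-unique a)

any-complete⇔ : (p : S → Bool) {xs : List S} → (∀ x → x ∈ₗ xs) → T (any p xs) ⇔ ∃ (T ∘ p)
any-complete⇔ p {xs} complete = mk⇔ (satisfied ∘ any⁻ p xs) (λ (x , px) → any⁺ p (lose (complete x) px))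

all-complete⇔ : (p : S → Bool) {xs : List S} → (∀ x → x ∈ₗ xs) → T (all p xs) ⇔ (∀ x → T (p x))
all-complete⇔ p {xs} complete = mk⇔
  (λ t x → All.lookup (all⁺ p xs t) (complete x))
  (λ h → all⁻ p {xs = xs} (All.tabulate (λ {x} _ → h x)))

T-not-∨⇔⇒ : ∀ {b c} → T (not b ∨ c) ⇔ (T b → T c)
T-not-∨⇔⇒ {true}  = mk⇔ (λ c _ → c) (λ h → h _)
T-not-∨⇔⇒ {false} = mk⇔ (λ _ ()) (λ _ → _)

T-∨⇔¬⇒ : ∀ {b c} → T (b ∨ c) ⇔ (¬ T b → T c)
T-∨⇔¬⇒ {true}  = mk⇔ (λ _ ¬t → ⊥-elim (¬t _)) (λ _ → _)
T-∨⇔¬⇒ {false} = mk⇔ (λ c _ → c) (λ h → h id)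

==ˢ⇔ : {X Y : Subset n} → T (X ==ˢ Y) ⇔ (X ≡ Y)
==ˢ⇔ = mk⇔ toWitness fromWitness

T-injective : ∀ {b c} → (T b ⇔ T c) → b ≡ c
T-injective b⇔c = ⇔→≡ {z = true} (⇔-trans (⇔-sym T-≡) (⇔-trans b⇔c T-≡))

T-not⇔ : ∀ {b} → T (not b) ⇔ (¬ T b)
T-not⇔ {true}  = mk⇔ (λ ()) (λ ¬t → ¬t _)
T-not⇔ {false} = mk⇔ (λ _ ()) (λ _ → _)

⊆ᵇ⇒⊆ : {X Y : Subset n} → T (X ⊆ᵇ Y) → X ⊆ Y
⊆ᵇ⇒⊆ {X = true ∷ X}  {true ∷ Y}  t here       = here
⊆ᵇ⇒⊆ {X = x ∷ X}     {y ∷ Y}     t (there i∈) = there (⊆ᵇ⇒⊆ (proj₂ (Equivalence.to (T-∧ {not x ∨ y}) t)) i∈)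

⊆⇒⊆ᵇ : {X Y : Subset n} → X ⊆ Y → T (X ⊆ᵇ Y)
⊆⇒⊆ᵇ {X = []}        {[]}        _   = _
⊆⇒⊆ᵇ {X = true ∷ X}  {true ∷ Y}  X⊆Y = ⊆⇒⊆ᵇ (drop-∷-⊆ X⊆Y)
⊆⇒⊆ᵇ {X = true ∷ X}  {false ∷ Y} X⊆Y with X⊆Y here
... | ()
⊆⇒⊆ᵇ {X = false ∷ X} {true ∷ Y}  X⊆Y = ⊆⇒⊆ᵇ (drop-∷-⊆ X⊆Y)
⊆⇒⊆ᵇ {X = false ∷ X} {false ∷ Y} X⊆Y = ⊆⇒⊆ᵇ (drop-∷-⊆ X⊆Y)

x∈p─q⁻ : ∀ {p q : Subset n} → x ∈ p ─ q → x ∈ p × x ∉ q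
x∈p─q⁻ {p = true ∷ p} {false ∷ q} here       = here , λ ()
x∈p─q⁻ {p = _ ∷ p}    {true ∷ q}  (there x∈) = Product.map there (λ x∉ → λ { (there x∈q) → x∉ x∈q }) (x∈p─q⁻ x∈)
x∈p─q⁻ {p = _ ∷ p}    {false ∷ q} (there x∈) = Product.map there (λ x∉ → λ { (there x∈q) → x∉ x∈q }) (x∈p─q⁻ x∈)

x∈p-y⁻ : ∀ {p : Subset n} → x ∈ p - y → x ∈ p × x ≢ y
x∈p-y⁻ {y = y} x∈ = Product.map₂ (λ x∉⁅y⁆ x≡y → x∉⁅y⁆ (subst (_∈ ⁅ y ⁆) (sym x≡y) (x∈⁅x⁆ y))) (x∈p─q⁻ x∈)

replace : Subset n → Fin n → Fin n → Subset n
replace B x y = (B - x) ∪ ⁅ y ⁆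

∈-replace⁻ : i ∈ replace B x y → (i ∈ B × i ≢ x) ⊎ i ≡ y
∈-replace⁻ {B = B} {x} {y} i∈ with x∈p∪q⁻ (B - x) ⁅ y ⁆ i∈
... | inj₁ i∈B-x  = inj₁ (x∈p-y⁻ i∈B-x)
... | inj₂ i∈⁅y⁆ = inj₂ (x∈⁅y⁆⇒x≡y y i∈⁅y⁆)

∈-replace⁺ : i ∈ B → i ≢ x → i ∈ replace B x y
∈-replace⁺ i∈B i≢x = x∈p∪q⁺ (inj₁ (x∈p∧x≢y⇒x∈p-y i∈B i≢x))

∈-replace-new : y ∈ replace B x y
∈-replace-new {y = y} = x∈p∪q⁺ (inj₂ (x∈⁅x⁆ y))

cost : Vec ℕ n → Subset n → ℕ
cost []      []      = 0
cost (v ∷ w) (b ∷ X) = (if b then v else 0) + cost w X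

cost-⊥ : (w : Vec ℕ n) → cost w ⊥ ≡ 0
cost-⊥ []      = refl
cost-⊥ (v ∷ w) = cost-⊥ w

cost-⁅⁆ : (w : Vec ℕ n) (x : Fin n) → cost w ⁅ x ⁆ ≡ lookup w x
cost-⁅⁆ (v ∷ w) zero    = trans (cong (v +_) (cost-⊥ w)) (ℕ.+-identityʳ v)
cost-⁅⁆ (v ∷ w) (suc x) = cost-⁅⁆ w x

cost-split : (w : Vec ℕ n) (X Y : Subset n) → cost w (X ∩ Y) + cost w (X ─ Y) ≡ cost w X
cost-split []      []          []          = refl
cost-split (v ∷ w) (true ∷ X)  (true ∷ Y)  =
  trans (ℕ.+-assoc v (cost w (X ∩ Y)) (cost w (X ─ Y))) (cong (v +_) (cost-split w X Y))
cost-split (v ∷ w) (true ∷ X)  (false ∷ Y) =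
  trans (x∙yz≈y∙xz (cost w (X ∩ Y)) v (cost w (X ─ Y))) (cong (v +_) (cost-split w X Y))
cost-split (v ∷ w) (false ∷ X) (true ∷ Y)  = cost-split w X Y
cost-split (v ∷ w) (false ∷ X) (false ∷ Y) = cost-split w X Y

cost-∪ : (w : Vec ℕ n) {X Y : Subset n} → (∀ {i} → i ∈ X → i ∉ Y) → cost w (X ∪ Y) ≡ cost w X + cost w Y
cost-∪ []      {[]}        {[]}        _        = refl
cost-∪ (v ∷ w) {true ∷ X}  {true ∷ Y}  disjoint = contradiction here (disjoint here)
cost-∪ (v ∷ w) {true ∷ X}  {false ∷ Y} disjoint =
  trans (cong (v +_) (cost-∪ w (λ i∈X i∈Y → disjoint (there i∈X) (there i∈Y))))
        (sym (ℕ.+-assoc v (cost w X) (cost w Y)))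
cost-∪ (v ∷ w) {false ∷ X} {y ∷ Y}     disjoint =
  trans (cong (_ +_) (cost-∪ w (λ i∈X i∈Y → disjoint (there i∈X) (there i∈Y))))
        (x∙yz≈y∙xz (if y then v else 0) (cost w X) (cost w Y))

cost-≤-*size : (w : Vec ℕ n) (X : Subset n) (c : ℕ) → (∀ {i} → i ∈ X → lookup w i ≤ c) → cost w X ≤ c * size X
cost-≤-*size []      []          c bound = z≤n
cost-≤-*size (v ∷ w) (true ∷ X)  c bound =
  subst (v + cost w X ≤_) (sym (ℕ.*-suc c (size X))) (ℕ.+-mono-≤ (bound here) (cost-≤-*size w X c (bound ∘ there)))
cost-≤-*size (v ∷ w) (false ∷ X) c bound = cost-≤-*size w X c (bound ∘ there)

*size-≤-cost : (w : Vec ℕ n) (X : Subset n) (c : ℕ) → (∀ {i} → i ∈ X → c ≤ lookup w i) → c * size X ≤ cost w X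
*size-≤-cost []      []          c bound = ℕ.≤-reflexive (ℕ.*-zeroʳ c)
*size-≤-cost (v ∷ w) (true ∷ X)  c bound =
  subst (_≤ v + cost w X) (sym (ℕ.*-suc c (size X))) (ℕ.+-mono-≤ (bound here) (*size-≤-cost w X c (bound ∘ there)))
*size-≤-cost (v ∷ w) (false ∷ X) c bound = *size-≤-cost w X c (bound ∘ there)

[B-x]∪⁅x⁆≡B : x ∈ B → (B - x) ∪ ⁅ x ⁆ ≡ B
[B-x]∪⁅x⁆≡B {x = x} {B = B} x∈B = ⊆-antisym ⊆B B⊆
  where
  ⊆B : (B - x) ∪ ⁅ x ⁆ ⊆ B
  ⊆B i∈ with x∈p∪q⁻ (B - x) ⁅ x ⁆ i∈
  ... | inj₁ i∈B-x  = p─q⊆p B ⁅ x ⁆ i∈B-x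
  ... | inj₂ i∈⁅x⁆ = subst (_∈ B) (sym (x∈⁅y⁆⇒x≡y x i∈⁅x⁆)) x∈B
  B⊆ : B ⊆ (B - x) ∪ ⁅ x ⁆
  B⊆ {i} i∈B with i ≟ᶠ x
  ... | yes refl = x∈p∪q⁺ (inj₂ (x∈⁅x⁆ x))
  ... | no  i≢x  = x∈p∪q⁺ (inj₁ (x∈p∧x≢y⇒x∈p-y i∈B i≢x))

cost-remove : (w : Vec ℕ n) → x ∈ B → cost w B ≡ cost w (B - x) + lookup w x
cost-remove {x = x} {B = B} w x∈B = begin
  cost w B                         ≡⟨ cong (cost w) ([B-x]∪⁅x⁆≡B x∈B) ⟨
  cost w ((B - x) ∪ ⁅ x ⁆)         ≡⟨ cost-∪ w (λ i∈B-x i∈⁅x⁆ → proj₂ (x∈p-y⁻ i∈B-x) (x∈⁅y⁆⇒x≡y x i∈⁅x⁆)) ⟩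
  cost w (B - x) + cost w ⁅ x ⁆    ≡⟨ cong (cost w (B - x) +_) (cost-⁅⁆ w x) ⟩
  cost w (B - x) + lookup w x      ∎
  where open ≡-Reasoning

cost-replace : (w : Vec ℕ n) → x ∈ B → y ∉ B → cost w (replace B x y) + lookup w x ≡ cost w B + lookup w y
cost-replace {x = x} {B = B} {y = y} w x∈B y∉B = begin
  cost w ((B - x) ∪ ⁅ y ⁆) + lookup w x            ≡⟨ cong (_+ lookup w x) (cost-∪ w disjoint) ⟩
  cost w (B - x) + cost w ⁅ y ⁆ + lookup w x       ≡⟨ cong (λ c → cost w (B - x) + c + lookup w x) (cost-⁅⁆ w y) ⟩
  cost w (B - x) + lookup w y + lookup w x         ≡⟨ xy∙z≈xz∙y (cost w (B - x)) (lookup w y) (lookup w x) ⟩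
  cost w (B - x) + lookup w x + lookup w y         ≡⟨ cong (_+ lookup w y) (cost-remove w x∈B) ⟨
  cost w B + lookup w y                            ∎
  where
  open ≡-Reasoning
  disjoint : ∀ {i} → i ∈ B - x → i ∉ ⁅ y ⁆
  disjoint i∈B-x i∈⁅y⁆ = y∉B (subst (_∈ B) (x∈⁅y⁆⇒x≡y y i∈⁅y⁆) (proj₁ (x∈p-y⁻ i∈B-x)))

ones : ∀ n → Vec ℕ n
ones n = replicate n 1

size≡cost-ones : (X : Subset n) → size X ≡ cost (ones n) X
size≡cost-ones []          = refl
size≡cost-ones (true ∷ X)  = cong suc (size≡cost-ones X)
size≡cost-ones (false ∷ X) = size≡cost-ones X

size≡∣∣ : (X : Subset n) → size X ≡ ∣ X ∣
size≡∣∣ []          = refl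
size≡∣∣ (true ∷ X)  = cong suc (size≡∣∣ X)
size≡∣∣ (false ∷ X) = size≡∣∣ X

size-split : (X Y : Subset n) → size (X ∩ Y) + size (X ─ Y) ≡ size X
size-split {n} X Y =
  subst₂ (λ a b → a + b ≡ size X) (sym (size≡cost-ones (X ∩ Y))) (sym (size≡cost-ones (X ─ Y)))
    (trans (cost-split (ones n) X Y) (sym (size≡cost-ones X)))

size-∪ : (∀ {i} → i ∈ X → i ∉ Y) → size (X ∪ Y) ≡ size X + size Y
size-∪ {n} {X} {Y} disjoint = begin
  size (X ∪ Y)                        ≡⟨ size≡cost-ones (X ∪ Y) ⟩
  cost (ones n) (X ∪ Y)               ≡⟨ cost-∪ (ones n) disjoint ⟩
  cost (ones n) X + cost (ones n) Y   ≡⟨ cong₂ _+_ (size≡cost-ones X) (size≡cost-ones Y) ⟨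
  size X + size Y                     ∎
  where open ≡-Reasoning

size-replace : x ∈ B → y ∉ B → size (replace B x y) ≡ size B
size-replace {n} {x} {B} {y} x∈B y∉B = ℕ.+-cancelʳ-≡ _ (size (replace B x y)) (size B) (begin
  size (replace B x y) + 1                     ≡⟨ cong₂ _+_ (size≡cost-ones (replace B x y)) (sym (lookup-replicate x 1)) ⟩
  cost (ones n) (replace B x y) + lookup (ones n) x ≡⟨ cost-replace (ones n) x∈B y∉B ⟩
  cost (ones n) B + lookup (ones n) y          ≡⟨ cong₂ _+_ (sym (size≡cost-ones B)) (lookup-replicate y 1) ⟩
  size B + 1                                   ∎)
  where open ≡-Reasoning

size-mono : X ⊆ Y → size X ≤ size Y
size-mono {X = X} {Y} X⊆Y = subst₂ _≤_ (sym (size≡∣∣ X)) (sym (size≡∣∣ Y)) (p⊆q⇒∣p∣≤∣q∣ X⊆Y)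

size-strict-mono : X ⊂ Y → size X < size Y
size-strict-mono {X = X} {Y} X⊂Y = subst₂ _<_ (sym (size≡∣∣ X)) (sym (size≡∣∣ Y)) (p⊂q⇒∣p∣<∣q∣ X⊂Y)

Empty-─⇒⊆ : ∀ {X Y : Subset n} → Empty (X ─ Y) → X ⊆ Y
Empty-─⇒⊆ {X = X} {Y} empty {i} i∈X with i ∈? Y
... | yes i∈Y = i∈Y
... | no  i∉Y = contradiction (i , x∈p∧x∉q⇒x∈p─q i∈X i∉Y) empty

⊆∧size≤⇒≡ : X ⊆ Y → size Y ≤ size X → X ≡ Y
⊆∧size≤⇒≡ {X = X} {Y} X⊆Y |Y|≤|X| with nonempty? (Y ─ X)
... | yes (i , i∈Y─X) = contradiction (size-strict-mono (X⊆Y , i , x∈p─q⁻ i∈Y─X)) (ℕ.≤⇒≯ |Y|≤|X|)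
... | no  Y─X-empty   = ⊆-antisym X⊆Y (Empty-─⇒⊆ Y─X-empty)

size-⁅⁆ : (x : Fin n) → size ⁅ x ⁆ ≡ 1
size-⁅⁆ {n} x = trans (size≡cost-ones ⁅ x ⁆) (trans (cost-⁅⁆ (ones n) x) (lookup-replicate x 1))

size-pos : x ∈ X → 0 < size X
size-pos {x = x} {X} x∈X = ℕ.<-≤-trans (s≤s z≤n) (subst (_≤ size X) (size-⁅⁆ x) (size-mono ⁅x⁆⊆X))
  where
  ⁅x⁆⊆X : ⁅ x ⁆ ⊆ X
  ⁅x⁆⊆X i∈⁅x⁆ = subst (_∈ X) (sym (x∈⁅y⁆⇒x≡y x i∈⁅x⁆)) x∈X

size-remove : x ∈ X → size (X - x) < size X
size-remove {x = x} {X} x∈X = subst₂ _<_ (sym (size≡∣∣ (X - x))) (sym (size≡∣∣ X)) (x∈p⇒∣p-x∣<∣p∣ x∈X)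

size-replace-─ : ∀ {X Y : Subset n} → x ∈ X → x ∉ Y → y ∈ Y → size (replace X x y ─ Y) < size (X ─ Y)
size-replace-─ {x = x} {y} {X} {Y} x∈X x∉Y y∈Y =
  ℕ.≤-<-trans (size-mono shrunk) (size-remove (x∈p∧x∉q⇒x∈p─q x∈X x∉Y))
  where
  shrunk : replace X x y ─ Y ⊆ (X ─ Y) - x
  shrunk i∈ with x∈p─q⁻ i∈
  ... | i∈X′ , i∉Y with ∈-replace⁻ i∈X′
  ...   | inj₁ (i∈X , i≢x) = x∈p∧x≢y⇒x∈p-y (x∈p∧x∉q⇒x∈p─q i∈X i∉Y) i≢x
  ...   | inj₂ refl        = contradiction y∈Y i∉Y

cost-replace-< : (w : Vec ℕ n) → x ∈ B → y ∉ B → lookup w y < lookup w x → cost w (replace B x y) < cost w B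
cost-replace-< {x = x} {B} {y} w x∈B y∉B wy<wx = ℕ.+-cancelʳ-< (lookup w x) _ _ (begin-strict
  cost w (replace B x y) + lookup w x   ≡⟨ cost-replace w x∈B y∉B ⟩
  cost w B + lookup w y                 <⟨ ℕ.+-monoʳ-< (cost w B) wy<wx ⟩
  cost w B + lookup w x                 ∎)
  where open ℕ.≤-Reasoning

cost-replace-<⁻ : (w : Vec ℕ n) → x ∈ B → y ∉ B → cost w B < cost w (replace B x y) → lookup w x < lookup w y
cost-replace-<⁻ {x = x} {B} {y} w x∈B y∉B B<B′ = ℕ.+-cancelˡ-< (cost w B) _ _ (begin-strict
  cost w B + lookup w x                 <⟨ ℕ.+-monoˡ-< (lookup w x) B<B′ ⟩
  cost w (replace B x y) + lookup w x   ≡⟨ cost-replace w x∈B y∉B ⟩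
  cost w B + lookup w y                 ∎)
  where open ℕ.≤-Reasoning

cost-<-by-difference : (w : Vec ℕ n) (c : ℕ) {X Y : Subset n} → size X ≡ size Y →
  (∀ {i} → i ∈ X ─ Y → lookup w i ≤ c) → (∀ {i} → i ∈ Y ─ X → c < lookup w i) →
  Nonempty (X ─ Y) → cost w X < cost w Y
cost-<-by-difference w c {X} {Y} |X|≡|Y| cheap dear (x , x∈X─Y) = begin-strict
  cost w X                             ≡⟨ cost-split w X Y ⟨
  cost w (X ∩ Y) + cost w (X ─ Y)      <⟨ ℕ.+-monoʳ-< (cost w (X ∩ Y)) difference< ⟩
  cost w (X ∩ Y) + cost w (Y ─ X)      ≡⟨ cong (λ Z → cost w Z + cost w (Y ─ X)) (∩-comm X Y) ⟩
  cost w (Y ∩ X) + cost w (Y ─ X)      ≡⟨ cost-split w Y X ⟩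
  cost w Y                             ∎
  where
  open ℕ.≤-Reasoning
  |X─Y|≡|Y─X| : size (X ─ Y) ≡ size (Y ─ X)
  |X─Y|≡|Y─X| = ℕ.+-cancelˡ-≡ (size (X ∩ Y)) _ _ (begin-equality
    size (X ∩ Y) + size (X ─ Y)   ≡⟨ size-split X Y ⟩
    size X                        ≡⟨ |X|≡|Y| ⟩
    size Y                        ≡⟨ size-split Y X ⟨
    size (Y ∩ X) + size (Y ─ X)   ≡⟨ cong (λ Z → size Z + size (Y ─ X)) (∩-comm Y X) ⟩
    size (X ∩ Y) + size (Y ─ X)   ∎)
  difference< : cost w (X ─ Y) < cost w (Y ─ X)
  difference< = begin-strict
    cost w (X ─ Y)         ≤⟨ cost-≤-*size w (X ─ Y) c cheap ⟩
    c * size (X ─ Y)       <⟨ ℕ.+-monoˡ-< (c * size (X ─ Y)) (size-pos x∈X─Y) ⟩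
    suc c * size (X ─ Y)   ≡⟨ cong (suc c *_) |X─Y|≡|Y─X| ⟩
    suc c * size (Y ─ X)   ≤⟨ *size-≤-cost w (Y ─ X) (suc c) dear ⟩
    cost w (Y ─ X)         ∎

module _ {X Y A : Subset n} (X∩A=∅ : ∀ {i} → i ∈ X → i ∉ A) (Y⊆A : Y ⊆ A) where

  disjoint-⊆ : ∀ {i} → i ∈ X → i ∉ Y
  disjoint-⊆ i∈X i∈Y = X∩A=∅ i∈X (Y⊆A i∈Y)

  [X∪Y]∩A≡Y : (X ∪ Y) ∩ A ≡ Y
  [X∪Y]∩A≡Y = ⊆-antisym ⊆Y (λ i∈Y → x∈p∩q⁺ (x∈p∪q⁺ (inj₂ i∈Y) , Y⊆A i∈Y))
    where
    ⊆Y : (X ∪ Y) ∩ A ⊆ Y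
    ⊆Y i∈ with x∈p∩q⁻ (X ∪ Y) A i∈
    ... | i∈X∪Y , i∈A with x∈p∪q⁻ X Y i∈X∪Y
    ...   | inj₁ i∈X = contradiction i∈A (X∩A=∅ i∈X)
    ...   | inj₂ i∈Y = i∈Y

  [X∪Y]─A≡X : (X ∪ Y) ─ A ≡ X
  [X∪Y]─A≡X = ⊆-antisym ⊆X (λ i∈X → x∈p∧x∉q⇒x∈p─q (x∈p∪q⁺ (inj₁ i∈X)) (X∩A=∅ i∈X))
    where
    ⊆X : (X ∪ Y) ─ A ⊆ X
    ⊆X i∈ with x∈p─q⁻ i∈
    ... | i∈X∪Y , i∉A with x∈p∪q⁻ X Y i∈X∪Y
    ...   | inj₁ i∈X = i∈X
    ...   | inj₂ i∈Y = contradiction (Y⊆A i∈Y) i∉A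

[X─A]∪[X∩A]≡X : (X A : Subset n) → (X ─ A) ∪ (X ∩ A) ≡ X
[X─A]∪[X∩A]≡X X A = ⊆-antisym ⊆X X⊆
  where
  ⊆X : (X ─ A) ∪ (X ∩ A) ⊆ X
  ⊆X i∈ with x∈p∪q⁻ (X ─ A) (X ∩ A) i∈
  ... | inj₁ i∈X─A = proj₁ (x∈p─q⁻ i∈X─A)
  ... | inj₂ i∈X∩A = proj₁ (x∈p∩q⁻ X A i∈X∩A)
  X⊆ : X ⊆ (X ─ A) ∪ (X ∩ A)
  X⊆ {i} i∈X with i ∈? A
  ... | yes i∈A = x∈p∪q⁺ (inj₂ (x∈p∩q⁺ (i∈X , i∈A)))
  ... | no  i∉A = x∈p∪q⁺ (inj₁ (x∈p∧x∉q⇒x∈p─q i∈X i∉A))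

cost-shift : (c : ℕ) (w : Vec ℕ n) (X : Subset n) → cost (Vec.map (c +_) w) X ≡ c * size X + cost w X
cost-shift c []      []          = sym (cong (_+ 0) (ℕ.*-zeroʳ c))
cost-shift c (v ∷ w) (true ∷ X)  = begin
  c + v + cost (Vec.map (c +_) w) X      ≡⟨ cong (c + v +_) (cost-shift c w X) ⟩
  c + v + (c * size X + cost w X)             ≡⟨ interchange c v (c * size X) (cost w X) ⟩
  c + c * size X + (v + cost w X)             ≡⟨ cong (_+ (v + cost w X)) (ℕ.*-suc c (size X)) ⟨
  c * suc (size X) + (v + cost w X)           ∎
  where open ≡-Reasoning
cost-shift c (v ∷ w) (false ∷ X) = cost-shift c w X

restrict : (A : Subset n) → Vec S n → Vec S (size A)
restrict []          []      = []
restrict (true ∷ A)  (x ∷ v) = x ∷ restrict A v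
restrict (false ∷ A) (x ∷ v) = restrict A v

restrict-lift : (S : Subset n) (Y : Subset (size S)) → restrict S (lift S Y) ≡ Y
restrict-lift []          []      = refl
restrict-lift (true ∷ S)  (y ∷ Y) = cong (y ∷_) (restrict-lift S Y)
restrict-lift (false ∷ S) Y       = restrict-lift S Y

lift-restrict : (S : Subset n) {X : Subset n} → X ⊆ S → lift S (restrict S X) ≡ X
lift-restrict []          {[]}        _   = refl
lift-restrict (true ∷ S)  {x ∷ X}     X⊆S = cong (x ∷_) (lift-restrict S (drop-∷-⊆ X⊆S))
lift-restrict (false ∷ S) {false ∷ X} X⊆S = cong (false ∷_) (lift-restrict S (drop-∷-⊆ X⊆S))
lift-restrict (false ∷ S) {true ∷ X}  X⊆S with X⊆S here
... | ()

lift-⊆ : (S : Subset n) (Y : Subset (size S)) → lift S Y ⊆ S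
lift-⊆ (true ∷ S)  (y ∷ Y) here       = here
lift-⊆ (true ∷ S)  (y ∷ Y) (there i∈) = there (lift-⊆ S Y i∈)
lift-⊆ (false ∷ S) Y       (there i∈) = there (lift-⊆ S Y i∈)

lift-mono : (S : Subset n) {Y Y′ : Subset (size S)} → Y ⊆ Y′ → lift S Y ⊆ lift S Y′
lift-mono (true ∷ S)  {y ∷ Y} {y′ ∷ Y′} Y⊆Y′ here with Y⊆Y′ here
... | here = here
lift-mono (true ∷ S)  {y ∷ Y} {y′ ∷ Y′} Y⊆Y′ (there i∈) = there (lift-mono S (drop-∷-⊆ Y⊆Y′) i∈)
lift-mono (false ∷ S) Y⊆Y′ (there i∈) = there (lift-mono S Y⊆Y′ i∈)

lift-mono⁻ : (S : Subset n) {Y Y′ : Subset (size S)} → lift S Y ⊆ lift S Y′ → Y ⊆ Y′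
lift-mono⁻ (true ∷ S)  {y ∷ Y} {y′ ∷ Y′} ⊆′ here with ⊆′ here
... | here = here
lift-mono⁻ (true ∷ S)  {y ∷ Y} {y′ ∷ Y′} ⊆′ (there i∈) = there (lift-mono⁻ S (drop-∷-⊆ ⊆′) i∈)
lift-mono⁻ (false ∷ S) ⊆′ i∈ = lift-mono⁻ S (drop-∷-⊆ ⊆′) i∈

cost-lift : (w : Vec ℕ n) (S : Subset n) (Y : Subset (size S)) → cost w (lift S Y) ≡ cost (restrict S w) Y
cost-lift []      []          []      = refl
cost-lift (v ∷ w) (true ∷ S)  (y ∷ Y) = cong (_ +_) (cost-lift w S Y)
cost-lift (v ∷ w) (false ∷ S) Y       = cost-lift w S Y

size-lift : (S : Subset n) (Y : Subset (size S)) → size (lift S Y) ≡ size Y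
size-lift []          []          = refl
size-lift (true ∷ S)  (true ∷ Y)  = cong suc (size-lift S Y)
size-lift (true ∷ S)  (false ∷ Y) = size-lift S Y
size-lift (false ∷ S) Y           = size-lift S Y

lift-∁-disjoint : (S : Subset n) (X : Subset (size (∁ S))) → ∀ {i} → i ∈ lift (∁ S) X → i ∉ S
lift-∁-disjoint S X = x∈∁p⇒x∉p ∘ lift-⊆ (∁ S) X

UniqueMin : {S : Set} → (S → Set) → (S → ℕ) → Set
UniqueMin {S} P c = ∃ λ B → P B × (∀ B′ → P B′ → B′ ≢ B → c B < c B′)

UniqueMin-transfer : {S S′ : Set} {P : S → Set} {P′ : S′ → Set} {c : S → ℕ} {c′ : S′ → ℕ}
  (φ : S → S′) (ψ : S′ → S) → (∀ {X} → P X → P′ (φ X)) → (∀ {Y} → P′ Y → P (ψ Y)) →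
  (∀ {Y} → P′ Y → φ (ψ Y) ≡ Y) → (∀ {X X′} → P X → P X′ → c X < c X′ → c′ (φ X) < c′ (φ X′)) →
  UniqueMin P c → UniqueMin P′ c′
UniqueMin-transfer {c′ = c′} φ ψ φ-pres ψ-pres φψ≡id φ-mono (B , pB , unique) =
  φ B , φ-pres pB , λ Y pY Y≢φB → subst (λ Z → c′ (φ B) < c′ Z) (φψ≡id pY)
    (φ-mono pB (ψ-pres pY) (unique (ψ Y) (ψ-pres pY) (λ ψY≡B → Y≢φB (trans (sym (φψ≡id pY)) (cong φ ψY≡B)))))

infix 4 _≟ˢ_
_≟ˢ_ : ∀ {n} (X Y : Subset n) → Dec (X ≡ Y)
_≟ˢ_ = ≡-dec _≟ᵇ_

uniqueMin-≤ : ∀ {n} {P : Subset n → Set} {c} ((B , _) : UniqueMin P c) → ∀ B′ → P B′ → c B ≤ c B′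
uniqueMin-≤ (B , _ , unique) B′ pB′ with B′ ≟ˢ B
... | yes refl   = ℕ.≤-refl
... | no  B′≢B  = ℕ.<⇒≤ (unique B′ pB′ B′≢B)

IsSublevel : ∀ {n} → Vec ℕ n → ℕ → Subset n → Set
IsSublevel w c A = (∀ {i} → i ∈ A → lookup w i ≤ c) × (∀ {i} → i ∉ A → c < lookup w i)

-- Matroids

module MatroidTheory {n : ℕ} (M : Matroid n) where

  Base : Subset n → Set
  Base B = T (isBase M B)

  -- Exchange the elements of B₂ outside B₁ ∪ I for elements of B₁ until there are none left.
  augment : ∀ {B₁ B₂ I} → Base B₁ → Base B₂ → I ⊆ B₂ →
            ∃ λ B₃ → Base B₃ × I ⊆ B₃ × B₃ ⊆ B₁ ∪ I × size B₃ ≡ size B₂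
  augment {B₁} {B₂} {I} b₁ b₂ I⊆B₂ = go b₂ I⊆B₂ refl (<-wellFounded _)
    where
    go : ∀ {B} → Base B → I ⊆ B → size B ≡ size B₂ → Acc _<_ (size (B ─ (B₁ ∪ I))) →
         ∃ λ B₃ → Base B₃ × I ⊆ B₃ × B₃ ⊆ B₁ ∪ I × size B₃ ≡ size B₂
    go {B} b I⊆B |B| (acc smaller) with nonempty? (B ─ (B₁ ∪ I))
    ... | no none = B , b , I⊆B , Empty-─⇒⊆ none , |B|
    ... | yes (x , x∈D) = step (exchange M B B₁ b b₁ x x∈B (x∉B₁∪I ∘ x∈p∪q⁺ ∘ inj₁))
      where
      x∈B = proj₁ (x∈p─q⁻ x∈D)
      x∉B₁∪I = proj₂ (x∈p─q⁻ x∈D)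
      step : (∃ λ y → y ∈ B₁ × y ∉ B × Base (replace B x y)) →
             ∃ λ B₃ → Base B₃ × I ⊆ B₃ × B₃ ⊆ B₁ ∪ I × size B₃ ≡ size B₂
      step (y , y∈B₁ , y∉B , b′) =
        go b′ I⊆B′ (trans (size-replace x∈B y∉B) |B|) (smaller (size-replace-─ x∈B x∉B₁∪I (x∈p∪q⁺ (inj₁ y∈B₁))))
        where
        I⊆B′ : I ⊆ replace B x y
        I⊆B′ {i} i∈I = ∈-replace⁺ (I⊆B i∈I) (λ { refl → x∉B₁∪I (x∈p∪q⁺ (inj₂ i∈I)) })

  base-⊆⇒≡ : Base B → Base B′ → B ⊆ B′ → B ≡ B′
  base-⊆⇒≡ {B} {B′} b b′ B⊆B′ with nonempty? (B′ ─ B)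
  ... | yes (x , x∈B′─B) =
    let (x∈B′ , x∉B) = x∈p─q⁻ x∈B′─B
        (y , y∈B , y∉B′ , _) = exchange M B′ B b′ b x x∈B′ x∉B
    in contradiction (B⊆B′ y∈B) y∉B′
  ... | no none = ⊆-antisym B⊆B′ (Empty-─⇒⊆ none)

  size-base : Base B → Base B′ → size B ≡ size B′
  size-base {B} {B′} b b′ with augment b b′ (λ i∈⊥ → contradiction i∈⊥ ∉⊥)
  ... | B₃ , b₃ , _ , B₃⊆B∪⊥ , |B₃| =
    trans (cong size (sym (base-⊆⇒≡ b₃ b (subst (B₃ ⊆_) (∪-identityʳ B) B₃⊆B∪⊥)))) |B₃|

  dual-exchange : ∀ {x} → Base B → Base B′ → x ∈ B → x ∉ B′ →
                  ∃ λ z → z ∈ B′ × z ∉ B × Base (replace B′ z x)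
  dual-exchange {B} {B′} {x} b b′ x∈B x∉B′ = finish (augment b′ b I⊆B)
    where
    I = (B ∩ B′) ∪ ⁅ x ⁆
    I⊆B : I ⊆ B
    I⊆B i∈I with x∈p∪q⁻ (B ∩ B′) ⁅ x ⁆ i∈I
    ... | inj₁ i∈B∩B′ = proj₁ (x∈p∩q⁻ B B′ i∈B∩B′)
    ... | inj₂ i∈⁅x⁆  = subst (_∈ B) (sym (x∈⁅y⁆⇒x≡y x i∈⁅x⁆)) x∈B
    x∈I : x ∈ I
    x∈I = x∈p∪q⁺ (inj₂ (x∈⁅x⁆ x))
    ∈B′∪I⁻ : ∀ {i} → i ∈ B′ ∪ I → i ∈ B′ ⊎ i ≡ x
    ∈B′∪I⁻ i∈ with x∈p∪q⁻ B′ I i∈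
    ... | inj₁ i∈B′ = inj₁ i∈B′
    ... | inj₂ i∈I with x∈p∪q⁻ (B ∩ B′) ⁅ x ⁆ i∈I
    ...   | inj₁ i∈B∩B′ = inj₁ (proj₂ (x∈p∩q⁻ B B′ i∈B∩B′))
    ...   | inj₂ i∈⁅x⁆  = inj₂ (x∈⁅y⁆⇒x≡y x i∈⁅x⁆)
    finish : (∃ λ B₃ → Base B₃ × I ⊆ B₃ × B₃ ⊆ B′ ∪ I × size B₃ ≡ size B) →
             ∃ λ z → z ∈ B′ × z ∉ B × Base (replace B′ z x)
    finish (B₃ , b₃ , I⊆B₃ , B₃⊆B′∪I , |B₃|) with nonempty? (B′ ─ B₃)
    ... | yes (z , z∈B′─B₃) = z , z∈B′ , z∉B , subst Base B₃≡B′[z↦x] b₃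
      where
      z∈B′ = proj₁ (x∈p─q⁻ z∈B′─B₃)
      z∉B₃ = proj₂ (x∈p─q⁻ z∈B′─B₃)
      z∉B : z ∉ B
      z∉B z∈B = z∉B₃ (I⊆B₃ (x∈p∪q⁺ (inj₁ (x∈p∩q⁺ (z∈B , z∈B′)))))
      B₃⊆B′[z↦x] : B₃ ⊆ replace B′ z x
      B₃⊆B′[z↦x] i∈B₃ with ∈B′∪I⁻ (B₃⊆B′∪I i∈B₃)
      ... | inj₁ i∈B′ = ∈-replace⁺ i∈B′ (λ { refl → z∉B₃ i∈B₃ })
      ... | inj₂ refl = ∈-replace-new
      B₃≡B′[z↦x] : B₃ ≡ replace B′ z x
      B₃≡B′[z↦x] = ⊆∧size≤⇒≡ B₃⊆B′[z↦x]
        (ℕ.≤-reflexive (trans (size-replace z∈B′ x∉B′) (trans (size-base b′ b) (sym |B₃|))))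
    ... | no none = contradiction (subst (x ∈_) (sym (base-⊆⇒≡ b′ b₃ (Empty-─⇒⊆ none))) (I⊆B₃ x∈I)) x∉B′

  LocallyOptimal : Vec ℕ n → Subset n → Set
  LocallyOptimal w B = ∀ {x y} → x ∈ B → y ∉ B → Base (replace B x y) → lookup w x < lookup w y

  uniqueMin⇒locallyOptimal : ∀ {w} ((B , _) : UniqueMin Base (cost w)) → LocallyOptimal w B
  uniqueMin⇒locallyOptimal {w} (B , b , minimal) x∈B y∉B b′ =
    cost-replace-<⁻ w x∈B y∉B (minimal _ b′ (λ B′≡B → y∉B (subst (_ ∈_) B′≡B ∈-replace-new)))

  -- With m a cheapest element of B′ ∖ B, dual exchanges give z ∈ B ∖ B′ with B - z + m a base, so that
  -- w z < w m, and then z′ ∈ B′ ∖ B with B′ - z′ + z a base, where w m ≤ w z′.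
  improving-exchange : ∀ {w B B′} → LocallyOptimal w B → Base B → Base B′ → Nonempty (B′ ─ B) →
                       ∃ λ B″ → Base B″ × cost w B″ < cost w B′ × size (B″ ─ B) < size (B′ ─ B)
  improving-exchange {w} {B} {B′} optimal b b′ nonempty
    with cheapest (lookup w) (_∈? (B′ ─ B)) (allFin n) ∈-allFin nonempty
  ... | m , m∈B′─B , m-cheapest with x∈p─q⁻ m∈B′─B
  ...   | m∈B′ , m∉B with dual-exchange b′ b m∈B′ m∉B
  ...     | z , z∈B , z∉B′ , b[z↦m] with dual-exchange b b′ z∈B z∉B′
  ...       | z′ , z′∈B′ , z′∉B , b″ =
    replace B′ z′ z , b″ ,
    cost-replace-< w z′∈B′ z∉B′ (ℕ.<-≤-trans (optimal z∈B m∉B b[z↦m]) (m-cheapest z′ (x∈p∧x∉q⇒x∈p─q z′∈B′ z′∉B))) ,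
    size-replace-─ z′∈B′ z′∉B z∈B

  locallyOptimal⇒uniqueMin : ∀ {w B} → Base B → LocallyOptimal w B → UniqueMin Base (cost w)
  locallyOptimal⇒uniqueMin {w} {B} b optimal = B , b , λ B′ b′ B′≢B → go b′ B′≢B (<-wellFounded _)
    where
    go : ∀ {B′} → Base B′ → B′ ≢ B → Acc _<_ (size (B′ ─ B)) → cost w B < cost w B′
    go {B′} b′ B′≢B (acc smaller) with nonempty? (B′ ─ B)
    ... | no none = contradiction (base-⊆⇒≡ b′ b (Empty-─⇒⊆ none)) B′≢B
    ... | yes nonempty = step (improving-exchange {w} optimal b b′ nonempty)
      where
      step : (∃ λ B″ → Base B″ × cost w B″ < cost w B′ × size (B″ ─ B) < size (B′ ─ B)) → cost w B < cost w B′
      step (B″ , b″ , B″<B′ , shrinks) with B″ ≟ˢ B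
      ... | yes B″≡B = subst (λ X → cost w X < cost w B′) B″≡B B″<B′
      ... | no  B″≢B = ℕ.<-trans (go b″ B″≢B (smaller shrinks)) B″<B′

  uniqueMin-order-invariant : ∀ {w w′} → (∀ x y → lookup w x < lookup w y → lookup w′ x < lookup w′ y) →
                              UniqueMin Base (cost w) → UniqueMin Base (cost w′)
  uniqueMin-order-invariant {w} {w′} w<⇒w′< min@(B , b , _) =
    locallyOptimal⇒uniqueMin {w′} b (λ x∈B y∉B b′ → w<⇒w′< _ _ (uniqueMin⇒locallyOptimal {w} min x∈B y∉B b′))

  cheapest-base : (w : Vec ℕ n) → ∃ λ B → Base B × (∀ B′ → Base B′ → cost w B ≤ cost w B′)
  cheapest-base w = cheapest (cost w) (T? ∘ isBase M) (allSubsets n) allSubsets-complete (nonempty M)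

  Independent : Subset n → Set
  Independent I = ∃ λ B → Base B × I ⊆ B

  record IsBasis (A Y : Subset n) : Set where
    field
      ⊆A          : Y ⊆ A
      independent : Independent Y
      maximal     : ∀ {Z} → Y ⊆ Z → Z ⊆ A → Independent Z → Z ≡ Y

  open IsBasis

  IsContractionBase : Subset n → Subset n → Set
  IsContractionBase A X = (∀ {i} → i ∈ X → i ∉ A) × ∃ λ Y → IsBasis A Y × Base (X ∪ Y)

  basis⇒trace : IsBasis A Y → ∃ λ B → Base B × B ∩ A ≡ Y
  basis⇒trace {A} {Y} Y-basis with independent Y-basis
  ... | B , b , Y⊆B =
    B , b , maximal Y-basis (λ i∈Y → x∈p∩q⁺ (Y⊆B i∈Y , ⊆A Y-basis i∈Y)) (p∩q⊆q B A) (B , b , p∩q⊆p B A)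

  basis-extends : Base B → IsBasis A Y →
                  ∃ λ B₃ → Base B₃ × B₃ ∩ A ≡ Y × B₃ ─ A ⊆ B ─ A × size B₃ ≡ size B
  basis-extends {B} {A} {Y} b Y-basis with independent Y-basis
  ... | B₂ , b₂ , Y⊆B₂ with augment b b₂ Y⊆B₂
  ...   | B₃ , b₃ , Y⊆B₃ , B₃⊆B∪Y , |B₃| =
    B₃ , b₃ , B₃∩A≡Y , B₃─A⊆B─A , trans |B₃| (size-base b₂ b)
    where
    B₃∩A≡Y : B₃ ∩ A ≡ Y
    B₃∩A≡Y = maximal Y-basis (λ i∈Y → x∈p∩q⁺ (Y⊆B₃ i∈Y , ⊆A Y-basis i∈Y)) (p∩q⊆q B₃ A) (B₃ , b₃ , p∩q⊆p B₃ A)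
    B₃─A⊆B─A : B₃ ─ A ⊆ B ─ A
    B₃─A⊆B─A i∈B₃─A with x∈p─q⁻ i∈B₃─A
    ... | i∈B₃ , i∉A with x∈p∪q⁻ B Y (B₃⊆B∪Y i∈B₃)
    ...   | inj₁ i∈B = x∈p∧x∉q⇒x∈p─q i∈B i∉A
    ...   | inj₂ i∈Y = contradiction (⊆A Y-basis i∈Y) i∉A

  basis-size-≤ : IsBasis A Y → IsBasis A Y′ → size Y ≤ size Y′
  basis-size-≤ {A} {Y} {Y′} Y-basis Y′-basis with basis⇒trace Y-basis
  ... | B , b , B∩A≡Y with basis-extends b Y′-basis
  ...   | B₃ , b₃ , B₃∩A≡Y′ , B₃─A⊆B─A , |B₃|≡|B| = ℕ.+-cancelʳ-≤ (size (B₃ ─ A)) (size Y) (size Y′) (begin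
    size Y + size (B₃ ─ A)         ≤⟨ ℕ.+-monoʳ-≤ (size Y) (size-mono B₃─A⊆B─A) ⟩
    size Y + size (B ─ A)          ≡⟨ cong (λ Z → size Z + size (B ─ A)) B∩A≡Y ⟨
    size (B ∩ A) + size (B ─ A)    ≡⟨ size-split B A ⟩
    size B                         ≡⟨ |B₃|≡|B| ⟨
    size B₃                        ≡⟨ size-split B₃ A ⟨
    size (B₃ ∩ A) + size (B₃ ─ A)  ≡⟨ cong (λ Z → size Z + size (B₃ ─ A)) B₃∩A≡Y′ ⟩
    size Y′ + size (B₃ ─ A)        ∎)
    where open ℕ.≤-Reasoning

  basis-size : IsBasis A Y → IsBasis A Y′ → size Y ≡ size Y′
  basis-size Y-basis Y′-basis = ℕ.≤-antisym (basis-size-≤ Y-basis Y′-basis) (basis-size-≤ Y′-basis Y-basis)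

  basis-exchange : (∀ {i} → i ∈ X → i ∉ A) → IsBasis A Y → IsBasis A Y′ → Base (X ∪ Y) → Base (X ∪ Y′)
  basis-exchange {X} {A} {Y} {Y′} X∩A=∅ Y-basis Y′-basis b with basis-extends b Y′-basis
  ... | B₃ , b₃ , B₃∩A≡Y′ , B₃─A⊆X∪Y─A , |B₃| = subst Base B₃≡X∪Y′ b₃
    where
    open ≡-Reasoning
    B₃─A⊆X : B₃ ─ A ⊆ X
    B₃─A⊆X = subst (B₃ ─ A ⊆_) ([X∪Y]─A≡X X∩A=∅ (⊆A Y-basis)) B₃─A⊆X∪Y─A
    |X|≡|B₃─A| : size X ≡ size (B₃ ─ A)
    |X|≡|B₃─A| = ℕ.+-cancelˡ-≡ (size Y′) _ _ (begin
      size Y′ + size X              ≡⟨ ℕ.+-comm (size Y′) (size X) ⟩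
      size X + size Y′              ≡⟨ cong (size X +_) (basis-size Y′-basis Y-basis) ⟩
      size X + size Y               ≡⟨ size-∪ (disjoint-⊆ X∩A=∅ (⊆A Y-basis)) ⟨
      size (X ∪ Y)                  ≡⟨ |B₃| ⟨
      size B₃                       ≡⟨ size-split B₃ A ⟨
      size (B₃ ∩ A) + size (B₃ ─ A) ≡⟨ cong (λ Z → size Z + size (B₃ ─ A)) B₃∩A≡Y′ ⟩
      size Y′ + size (B₃ ─ A)       ∎)
    B₃≡X∪Y′ : B₃ ≡ X ∪ Y′
    B₃≡X∪Y′ = begin
      B₃                      ≡⟨ [X─A]∪[X∩A]≡X B₃ A ⟨
      (B₃ ─ A) ∪ (B₃ ∩ A)     ≡⟨ cong₂ _∪_ (⊆∧size≤⇒≡ B₃─A⊆X (ℕ.≤-reflexive |X|≡|B₃─A|)) B₃∩A≡Y′ ⟩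
      X ∪ Y′                  ∎

  contraction-size : IsContractionBase A X → IsContractionBase A X′ → size X ≡ size X′
  contraction-size {A} {X} {X′} (X∩A=∅ , Y , Y-basis , b) (X′∩A=∅ , Y′ , Y′-basis , b′) =
    ℕ.+-cancelʳ-≡ (size Y) (size X) (size X′) (begin
      size X + size Y       ≡⟨ size-∪ (disjoint-⊆ X∩A=∅ (⊆A Y-basis)) ⟨
      size (X ∪ Y)          ≡⟨ size-base b b′ ⟩
      size (X′ ∪ Y′)        ≡⟨ size-∪ (disjoint-⊆ X′∩A=∅ (⊆A Y′-basis)) ⟩
      size X′ + size Y′     ≡⟨ cong (size X′ +_) (basis-size Y′-basis Y-basis) ⟩
      size X′ + size Y      ∎)
    where open ≡-Reasoning

  -- Otherwise augmenting B ∩ A inside A yields a base exchanging elements of B outside A for cheaper ones in A.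
  cheapest-base-trace : ∀ {w c} → IsSublevel w c A → Base B → (∀ B′ → Base B′ → cost w B ≤ cost w B′) →
                        IsBasis A (B ∩ A)
  cheapest-base-trace {A} {B} {w} {c} (cheap , dear) b cheapest-B = record
    { ⊆A          = p∩q⊆q B A
    ; independent = B , b , p∩q⊆p B A
    ; maximal     = maximal′
    }
    where
    maximal′ : ∀ {Z} → B ∩ A ⊆ Z → Z ⊆ A → Independent Z → Z ≡ B ∩ A
    maximal′ {Z} B∩A⊆Z Z⊆A (B₂ , b₂ , Z⊆B₂) with nonempty? (Z ─ (B ∩ A))
    ... | no none = ⊆-antisym (Empty-─⇒⊆ none) B∩A⊆Z
    ... | yes (y , y∈Z─B∩A) with augment b b₂ Z⊆B₂
    ...   | B₃ , b₃ , Z⊆B₃ , B₃⊆B∪Z , |B₃| =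
      contradiction (cheapest-B B₃ b₃)
        (ℕ.<⇒≱ (cost-<-by-difference w c (trans |B₃| (size-base b₂ b)) cheap′ dear′ (y , y∈B₃─B)))
      where
      y∈B₃─B : y ∈ B₃ ─ B
      y∈B₃─B with x∈p─q⁻ y∈Z─B∩A
      ... | y∈Z , y∉B∩A = x∈p∧x∉q⇒x∈p─q (Z⊆B₃ y∈Z) (λ y∈B → y∉B∩A (x∈p∩q⁺ (y∈B , Z⊆A y∈Z)))
      cheap′ : ∀ {i} → i ∈ B₃ ─ B → lookup w i ≤ c
      cheap′ i∈B₃─B with x∈p─q⁻ i∈B₃─B
      ... | i∈B₃ , i∉B with x∈p∪q⁻ B Z (B₃⊆B∪Z i∈B₃)
      ...   | inj₁ i∈B = contradiction i∈B i∉B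
      ...   | inj₂ i∈Z = cheap (Z⊆A i∈Z)
      dear′ : ∀ {i} → i ∈ B ─ B₃ → c < lookup w i
      dear′ i∈B─B₃ with x∈p─q⁻ i∈B─B₃
      ... | i∈B , i∉B₃ = dear (λ i∈A → i∉B₃ (Z⊆B₃ (B∩A⊆Z (x∈p∩q⁺ (i∈B , i∈A)))))

  module _ {w : Vec ℕ n} {c : ℕ} {A : Subset n} (sublevel : IsSublevel w c A) where

    private
      cost-∪-parts : (∀ {i} → i ∈ X → i ∉ A) → IsBasis A Y → cost w (X ∪ Y) ≡ cost w X + cost w Y
      cost-∪-parts X∩A=∅ Y-basis = cost-∪ w (disjoint-⊆ X∩A=∅ (⊆A Y-basis))

      outside : ∀ {i} → i ∈ B ─ A → i ∉ A
      outside = proj₂ ∘ x∈p─q⁻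

      parts : Base B → (∀ B′ → Base B′ → cost w B ≤ cost w B′) →
              IsBasis A (B ∩ A) × IsContractionBase A (B ─ A) × cost w B ≡ cost w (B ─ A) + cost w (B ∩ A)
      parts {B} b cheapest-B =
        B∩A-basis , (outside , B ∩ A , B∩A-basis , subst Base (sym ([X─A]∪[X∩A]≡X B A)) b) ,
        trans (cong (cost w) (sym ([X─A]∪[X∩A]≡X B A))) (cost-∪-parts outside B∩A-basis)
        where
        B∩A-basis = cheapest-base-trace {w = w} sublevel b cheapest-B

    uniqueMin-split : UniqueMin Base (cost w) →
                      UniqueMin (IsBasis A) (cost w) × UniqueMin (IsContractionBase A) (cost w)
    uniqueMin-split min@(B , b , B-unique) with parts b (uniqueMin-≤ min)
    ... | Y-basis , X-contraction , cost-B =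
      (B ∩ A , Y-basis , Y-unique) , (B ─ A , X-contraction , X-unique)
      where
      open ℕ.≤-Reasoning
      b′ : Base ((B ─ A) ∪ (B ∩ A))
      b′ = subst Base (sym ([X─A]∪[X∩A]≡X B A)) b
      Y-unique : ∀ Y′ → IsBasis A Y′ → Y′ ≢ B ∩ A → cost w (B ∩ A) < cost w Y′
      Y-unique Y′ Y′-basis Y′≢ = ℕ.+-cancelˡ-< (cost w (B ─ A)) _ _ (begin-strict
        cost w (B ─ A) + cost w (B ∩ A)   ≡⟨ cost-B ⟨
        cost w B                          <⟨ B-unique _ (basis-exchange outside Y-basis Y′-basis b′) ≢B ⟩
        cost w ((B ─ A) ∪ Y′)             ≡⟨ cost-∪-parts outside Y′-basis ⟩
        cost w (B ─ A) + cost w Y′        ∎)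
        where
        ≢B : (B ─ A) ∪ Y′ ≢ B
        ≢B eq = Y′≢ (trans (sym ([X∪Y]∩A≡Y outside (⊆A Y′-basis))) (cong (_∩ A) eq))
      X-unique : ∀ X′ → IsContractionBase A X′ → X′ ≢ B ─ A → cost w (B ─ A) < cost w X′
      X-unique X′ (X′∩A=∅ , Y₀ , Y₀-basis , b₀) X′≢ = ℕ.+-cancelʳ-< (cost w (B ∩ A)) _ _ (begin-strict
        cost w (B ─ A) + cost w (B ∩ A)   ≡⟨ cost-B ⟨
        cost w B                          <⟨ B-unique _ (basis-exchange X′∩A=∅ Y₀-basis Y-basis b₀) ≢B ⟩
        cost w (X′ ∪ (B ∩ A))             ≡⟨ cost-∪-parts X′∩A=∅ Y-basis ⟩
        cost w X′ + cost w (B ∩ A)        ∎)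
        where
        ≢B : X′ ∪ (B ∩ A) ≢ B
        ≢B eq = X′≢ (trans (sym ([X∪Y]─A≡X X′∩A=∅ (⊆A Y-basis))) (cong (_─ A) eq))

    uniqueMin-merge : UniqueMin (IsBasis A) (cost w) → UniqueMin (IsContractionBase A) (cost w) →
                      UniqueMin Base (cost w)
    uniqueMin-merge Ymin@(Y , Y-basis , Y-unique) Xmin@(X , (X∩A=∅ , Y₀ , Y₀-basis , b₀) , X-unique) =
      X ∪ Y , b , B-unique
      where
      b : Base (X ∪ Y)
      b = basis-exchange X∩A=∅ Y₀-basis Y-basis b₀
      X∪Y-cheaper : ∀ {B′} → cost w B′ ≡ cost w (B′ ─ A) + cost w (B′ ∩ A) →
                    cost w X + cost w Y < cost w (B′ ─ A) + cost w (B′ ∩ A) → cost w (X ∪ Y) < cost w B′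
      X∪Y-cheaper cost-B′ = subst₂ _<_ (sym (cost-∪-parts X∩A=∅ Y-basis)) (sym cost-B′)
      -- A cheapest base B′ splits into B′ ─ A and B′ ∩ A, which cost at least as much as X and Y,
      -- strictly more unless they coincide.
      cheapest-is-X∪Y : ∀ {B′} → Base B′ → (∀ B″ → Base B″ → cost w B′ ≤ cost w B″) → B′ ≡ X ∪ Y
      cheapest-is-X∪Y {B′} b′ cheapest-B′ with parts b′ cheapest-B′ | B′ ∩ A ≟ˢ Y | B′ ─ A ≟ˢ X
      ... | _ | yes B′∩A≡Y | yes B′─A≡X = trans (sym ([X─A]∪[X∩A]≡X B′ A)) (cong₂ _∪_ B′─A≡X B′∩A≡Y)
      ... | Y′-basis , X′-contraction , cost-B′ | no B′∩A≢Y | _ =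
        contradiction (cheapest-B′ _ b) (ℕ.<⇒≱ (X∪Y-cheaper cost-B′
          (ℕ.+-mono-≤-< (uniqueMin-≤ Xmin _ X′-contraction) (Y-unique _ Y′-basis B′∩A≢Y))))
      ... | Y′-basis , X′-contraction , cost-B′ | yes _ | no B′─A≢X =
        contradiction (cheapest-B′ _ b) (ℕ.<⇒≱ (X∪Y-cheaper cost-B′
          (ℕ.+-mono-<-≤ (X-unique _ X′-contraction B′─A≢X) (uniqueMin-≤ Ymin _ Y′-basis))))
      B-unique : ∀ B′ → Base B′ → B′ ≢ X ∪ Y → cost w (X ∪ Y) < cost w B′
      B-unique B′ b′ B′≢B with cheapest-base w
      ... | Bm , bm , cheapest-Bm with cheapest-is-X∪Y bm cheapest-Bm
      ...   | refl = ℕ.≤∧≢⇒< (cheapest-Bm B′ b′)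
        (λ eq → B′≢B (cheapest-is-X∪Y b′ (λ B″ b″ → subst (_≤ cost w B″) eq (cheapest-Bm B″ b″))))

-- Generic functions

values : Vec (Fin k) n → Vec ℕ n
values = Vec.map (suc ∘ toℕ)

weight≡cost : (f : Vec (Fin k) n) (B : Subset n) → weight f B ≡ cost (values f) B
weight≡cost []      []      = refl
weight≡cost (v ∷ f) (b ∷ B) = cong (_ +_) (weight≡cost f B)

isGeneric⇔ : (𝓑 : BaseFamily n) (f : Vec (Fin k) n) → T (isGeneric 𝓑 f) ⇔ UniqueMin (T ∘ 𝓑) (cost (values f))
isGeneric⇔ {n} 𝓑 f = mk⇔ to from
  where
  beaten : Subset n → Subset n → Bool
  beaten B B′ = not (𝓑 B′) ∨ (B′ ==ˢ B) ∨ (weight f B <ᵇ weight f B′)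
  beaten⇔ : ∀ B B′ → T (beaten B B′) ⇔ (T (𝓑 B′) → B′ ≢ B → cost (values f) B < cost (values f) B′)
  beaten⇔ B B′ = mk⇔
    (λ t b′ B′≢B → subst₂ _<_ (weight≡cost f B) (weight≡cost f B′)
      (ℕ.<ᵇ⇒< _ _ (Equivalence.to T-∨⇔¬⇒ (Equivalence.to T-not-∨⇔⇒ t b′) (B′≢B ∘ Equivalence.to ==ˢ⇔))))
    (λ h → Equivalence.from T-not-∨⇔⇒ (λ b′ → Equivalence.from T-∨⇔¬⇒ (λ ¬B′≡B →
      ℕ.<⇒<ᵇ (subst₂ _<_ (sym (weight≡cost f B)) (sym (weight≡cost f B′))
        (h b′ (¬B′≡B ∘ Equivalence.from ==ˢ⇔))))))
  to : T (isGeneric 𝓑 f) → UniqueMin (T ∘ 𝓑) (cost (values f))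
  to t with Equivalence.to (any-complete⇔ _ allSubsets-complete) t
  ... | B , t′ with Equivalence.to T-∧ t′
  ...   | b , unique =
    B , b , λ B′ → Equivalence.to (beaten⇔ B B′) (Equivalence.to (all-complete⇔ _ allSubsets-complete) unique B′)
  from : UniqueMin (T ∘ 𝓑) (cost (values f)) → T (isGeneric 𝓑 f)
  from (B , b , unique) = Equivalence.from (any-complete⇔ _ allSubsets-complete)
    (B , Equivalence.from T-∧ (b , Equivalence.from (all-complete⇔ _ allSubsets-complete)
                                      (λ B′ → Equivalence.from (beaten⇔ B B′) (unique B′))))

hasFibres : Vec (Fin k) n → Vec ℕ k → Bool
hasFibres {k} f a = all (λ i → fibre f i ≡ᵇ lookup a i) (allFin k)

hasFibres⇔ : (f : Vec (Fin k) n) (a : Vec ℕ k) → T (hasFibres f a) ⇔ (∀ i → fibre f i ≡ lookup a i)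
hasFibres⇔ f a = mk⇔
  (λ t i → ℕ.≡ᵇ⇒≡ _ _ (Equivalence.to (all-complete⇔ _ ∈-allFin) t i))
  (λ h → Equivalence.from (all-complete⇔ _ ∈-allFin) (λ i → ℕ.≡⇒≡ᵇ _ _ (h i)))

contributes : BaseFamily n → Vec ℕ k → Vec (Fin k) n → Bool
contributes 𝓑 a f = isGeneric 𝓑 f ∧ hasFibres f a

-- coeffF 𝓑 k a is, by definition, length (contributing 𝓑 a).
contributing : BaseFamily n → Vec ℕ k → List (Vec (Fin k) n)
contributing {n} {k} 𝓑 a = filterᵇ (contributes 𝓑 a) (allFuns n k)

contributing-unique : (𝓑 : BaseFamily n) (a : Vec ℕ k) → Unique (contributing 𝓑 a)
contributing-unique {n} {k} 𝓑 a = Unique.filter⁺ (T? ∘ contributes 𝓑 a) (allFuns-unique n k)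

∈-contributing⇔ : (𝓑 : BaseFamily n) (a : Vec ℕ k) {f : Vec (Fin k) n} →
                  f ∈ₗ contributing 𝓑 a ⇔ T (contributes 𝓑 a f)
∈-contributing⇔ 𝓑 a = ∈-filterᵇ⇔ (contributes 𝓑 a) allFuns-complete

contributes⇔ : (𝓑 : BaseFamily n) (a : Vec ℕ k) (f : Vec (Fin k) n) →
               T (contributes 𝓑 a f) ⇔ (UniqueMin (T ∘ 𝓑) (cost (values f)) × (∀ i → fibre f i ≡ lookup a i))
contributes⇔ 𝓑 a f = mk⇔
  (λ t → let (g , h) = Equivalence.to T-∧ t in Equivalence.to (isGeneric⇔ 𝓑 f) g , Equivalence.to (hasFibres⇔ f a) h)
  (λ (g , h) → Equivalence.from T-∧ (Equivalence.from (isGeneric⇔ 𝓑 f) g , Equivalence.from (hasFibres⇔ f a) h))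

-- Quasisymmetry

fibre-map : ∀ {k₂} (φ : Fin k₂ → Fin k) → Injective _≡_ _≡_ φ → (g : Vec (Fin k₂) n) (j : Fin k₂) →
            fibre (Vec.map φ g) (φ j) ≡ fibre g j
fibre-map φ φ-inj []      j = refl
fibre-map φ φ-inj (v ∷ g) j with φ v ≟ᶠ φ j | v ≟ᶠ j
... | yes _      | yes _   = cong suc (fibre-map φ φ-inj g j)
... | no  _      | no  _   = fibre-map φ φ-inj g j
... | yes φv≡φj  | no v≢j  = contradiction (φ-inj φv≡φj) v≢j
... | no  φv≢φj  | yes v≡j = contradiction (cong φ v≡j) φv≢φj

fibre-map-outside : ∀ {k₂} (φ : Fin k₂ → Fin k) (g : Vec (Fin k₂) n) (i : Fin k) → (∀ j → φ j ≢ i) →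
                    fibre (Vec.map φ g) i ≡ 0
fibre-map-outside φ []      i outside = refl
fibre-map-outside φ (v ∷ g) i outside with φ v ≟ᶠ i
... | yes φv≡i = contradiction φv≡i (outside v)
... | no  _    = fibre-map-outside φ g i outside

fibre-lookup : (f : Vec (Fin k) n) (x : Fin n) → 0 < fibre f (lookup f x)
fibre-lookup (v ∷ f) zero with v ≟ᶠ v
... | yes _   = s≤s z≤n
... | no  v≢v = contradiction refl v≢v
fibre-lookup (v ∷ f) (suc x) with v ≟ᶠ lookup f x
... | yes _ = s≤s z≤n
... | no  _ = fibre-lookup f x

width : Vec ℕ k → ℕ
width a = length (flatten a)

position : (a : Vec ℕ k) → Fin (width a) → Fin k
position (zero  ∷ a) j       = suc (position a j)
position (suc _ ∷ a) zero    = zero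
position (suc _ ∷ a) (suc j) = suc (position a j)

lookup-position : (a : Vec ℕ k) (j : Fin (width a)) → lookup a (position a j) ≡ lookup (fromList (flatten a)) j
lookup-position (zero  ∷ a) j       = lookup-position a j
lookup-position (suc _ ∷ a) zero    = refl
lookup-position (suc _ ∷ a) (suc j) = lookup-position a j

position-nonzero : (a : Vec ℕ k) (j : Fin (width a)) → lookup a (position a j) ≢ 0
position-nonzero (zero  ∷ a) j       = position-nonzero a j
position-nonzero (suc _ ∷ a) zero    = λ ()
position-nonzero (suc _ ∷ a) (suc j) = position-nonzero a j

position-surjective : (a : Vec ℕ k) (i : Fin k) → lookup a i ≢ 0 → ∃ λ j → position a j ≡ i
position-surjective (zero  ∷ a) zero    a₀≢0 = contradiction refl a₀≢0
position-surjective (zero  ∷ a) (suc i) aᵢ≢0 = Product.map₂ (cong suc) (position-surjective a i aᵢ≢0)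
position-surjective (suc _ ∷ a) zero    _    = zero , refl
position-surjective (suc _ ∷ a) (suc i) aᵢ≢0 = Product.map suc (cong suc) (position-surjective a i aᵢ≢0)

position-<⁺ : (a : Vec ℕ k) {j j′ : Fin (width a)} → toℕ j < toℕ j′ → toℕ (position a j) < toℕ (position a j′)
position-<⁺ (zero  ∷ a) j<j′                  = s≤s (position-<⁺ a j<j′)
position-<⁺ (suc _ ∷ a) {zero}  {suc j′} _    = s≤s z≤n
position-<⁺ (suc _ ∷ a) {suc j} {suc j′} (s≤s j<j′) = s≤s (position-<⁺ a j<j′)

position-<⁻ : (a : Vec ℕ k) {j j′ : Fin (width a)} → toℕ (position a j) < toℕ (position a j′) → toℕ j < toℕ j′
position-<⁻ (zero  ∷ a) (s≤s p<p′)                 = position-<⁻ a p<p′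
position-<⁻ (suc _ ∷ a) {zero}  {suc j′} _           = s≤s z≤n
position-<⁻ (suc _ ∷ a) {suc j} {suc j′} (s≤s p<p′) = s≤s (position-<⁻ a p<p′)

position-injective : (a : Vec ℕ k) → Injective _≡_ _≡_ (position a)
position-injective (zero  ∷ a) eq = position-injective a (suc-injective eq)
position-injective (suc _ ∷ a) {zero}  {zero}  eq = refl
position-injective (suc _ ∷ a) {suc j} {suc j′} eq = cong suc (position-injective a (suc-injective eq))

map-injective : ∀ {A B : Set} {f : A → B} → Injective _≡_ _≡_ f → Injective _≡_ _≡_ (Vec.map {n = n} f)
map-injective f-inj {[]}    {[]}    _  = refl
map-injective f-inj {x ∷ u} {y ∷ v} eq =
  cong₂ _∷_ (f-inj (proj₁ (∷-injective eq))) (map-injective f-inj (proj₂ (∷-injective eq)))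

lookup-values-map : ∀ {k₂} (φ : Fin k₂ → Fin k) (g : Vec (Fin k₂) n) (x : Fin n) →
                    lookup (values (Vec.map φ g)) x ≡ suc (toℕ (φ (lookup g x)))
lookup-values-map φ g x = trans (lookup-map x _ (Vec.map φ g)) (cong (suc ∘ toℕ) (lookup-map x φ g))

module _ (M : Matroid n) (a : Vec ℕ k) where

  open MatroidTheory M using (uniqueMin-order-invariant)

  private
    𝓑 = isBase M
    a′ = fromList (flatten a)

  module _ (g : Vec (Fin (width a)) n) where

    private
      f = Vec.map (position a) g
      values-<⇔ : ∀ x y → lookup (values g) x < lookup (values g) y ⇔ lookup (values f) x < lookup (values f) y
      values-<⇔ x y = mk⇔
        (λ lt → subst₂ _<_ (sym (lookup-values-map (position a) g x)) (sym (lookup-values-map (position a) g y))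
                  (s≤s (position-<⁺ a (ℕ.≤-pred (subst₂ _<_ (lookup-map x _ g) (lookup-map y _ g) lt)))))
        (λ lt → subst₂ _<_ (sym (lookup-map x _ g)) (sym (lookup-map y _ g))
                  (s≤s (position-<⁻ a (ℕ.≤-pred (subst₂ _<_ (lookup-values-map (position a) g x)
                                                           (lookup-values-map (position a) g y) lt)))))

    generic-position⇔ : UniqueMin (T ∘ 𝓑) (cost (values f)) ⇔ UniqueMin (T ∘ 𝓑) (cost (values g))
    generic-position⇔ = mk⇔
      (uniqueMin-order-invariant {values f} {values g} (λ x y → Equivalence.from (values-<⇔ x y)))
      (uniqueMin-order-invariant {values g} {values f} (λ x y → Equivalence.to (values-<⇔ x y)))

    fibres-position⇔ : (∀ i → fibre f i ≡ lookup a i) ⇔ (∀ j → fibre g j ≡ lookup a′ j)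
    fibres-position⇔ = mk⇔
      (λ fibres j → begin
        fibre g j                    ≡⟨ fibre-map (position a) (position-injective a) g j ⟨
        fibre f (position a j)       ≡⟨ fibres (position a j) ⟩
        lookup a (position a j)      ≡⟨ lookup-position a j ⟩
        lookup a′ j                  ∎)
      (λ fibres i → fibres-at fibres i (lookup a i ℕ.≟ 0))
      where
      open ≡-Reasoning
      fibres-at : (∀ j → fibre g j ≡ lookup a′ j) → ∀ i → Dec (lookup a i ≡ 0) → fibre f i ≡ lookup a i
      fibres-at fibres i (yes aᵢ≡0) = trans
        (fibre-map-outside (position a) g i (λ j pⱼ≡i → position-nonzero a j (trans (cong (lookup a) pⱼ≡i) aᵢ≡0)))
        (sym aᵢ≡0)
      fibres-at fibres i (no aᵢ≢0) with position-surjective a i aᵢ≢0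
      ... | j , refl = begin
        fibre f (position a j)       ≡⟨ fibre-map (position a) (position-injective a) g j ⟩
        fibre g j                    ≡⟨ fibres j ⟩
        lookup a′ j                  ≡⟨ lookup-position a j ⟨
        lookup a (position a j)      ∎

    contributes-position⇔ : T (contributes 𝓑 a f) ⇔ T (contributes 𝓑 a′ g)
    contributes-position⇔ = mk⇔
      (λ t → let (generic , fibres) = Equivalence.to (contributes⇔ 𝓑 a f) t in
        Equivalence.from (contributes⇔ 𝓑 a′ g)
          (Equivalence.to generic-position⇔ generic , Equivalence.to fibres-position⇔ fibres))
      (λ t → let (generic , fibres) = Equivalence.to (contributes⇔ 𝓑 a′ g) t in
        Equivalence.from (contributes⇔ 𝓑 a f)
          (Equivalence.from generic-position⇔ generic , Equivalence.from fibres-position⇔ fibres))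

  values-in-support : (f : Vec (Fin k) n) → (∀ i → fibre f i ≡ lookup a i) → ∀ x → lookup a (lookup f x) ≢ 0
  values-in-support f fibres x aᵢ≡0 = ℕ.<⇒≢ (fibre-lookup f x) (sym (trans (fibres (lookup f x)) aᵢ≡0))

  coeffF-flatten : coeffF 𝓑 k a ≡ coeffF 𝓑 (width a) a′
  coeffF-flatten = length-filterᵇ-image (contributes 𝓑 a) (Vec.map (position a)) (allFuns-unique n k) allFuns-complete
    (contributing-unique 𝓑 a′) (map-injective (position-injective a)) image
    where
    image : ∀ f → T (contributes 𝓑 a f) ⇔ (∃ λ g → g ∈ₗ contributing 𝓑 a′ × Vec.map (position a) g ≡ f)
    image f = mk⇔ preimage
      (λ { (g , g∈ , refl) → Equivalence.from (contributes-position⇔ g) (Equivalence.to (∈-contributing⇔ 𝓑 a′) g∈) })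
      where
      preimage : T (contributes 𝓑 a f) → ∃ λ g → g ∈ₗ contributing 𝓑 a′ × Vec.map (position a) g ≡ f
      preimage t = g , Equivalence.from (∈-contributing⇔ 𝓑 a′)
                         (Equivalence.to (contributes-position⇔ g) (subst (T ∘ contributes 𝓑 a) (sym g↦f) t)) , g↦f
        where
        nonzero : ∀ x → lookup a (lookup f x) ≢ 0
        nonzero = values-in-support f (proj₂ (Equivalence.to (contributes⇔ 𝓑 a f) t))
        g = tabulate (λ x → proj₁ (position-surjective a (lookup f x) (nonzero x)))
        g↦f : Vec.map (position a) g ≡ f
        g↦f = trans (sym (tabulate-∘ (position a) _))
                (trans (tabulate-cong (λ x → proj₂ (position-surjective a (lookup f x) (nonzero x)))) (tabulate∘lookup f))

-- Invariance under isomorphism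

permute : Permutation′ n → Vec S n → Vec S n
permute σ v = tabulate (λ i → lookup v (σ ⟨$⟩ʳ i))

permute-flip : (σ : Permutation′ n) (v : Vec S n) → permute σ (permute (flip σ) v) ≡ v
permute-flip σ v = trans
  (tabulate-cong (λ i → trans (lookup∘tabulate _ (σ ⟨$⟩ʳ i)) (cong (lookup v) (inverseˡ σ))))
  (tabulate∘lookup v)

flip-permute : (σ : Permutation′ n) (v : Vec S n) → permute (flip σ) (permute σ v) ≡ v
flip-permute σ v = trans
  (tabulate-cong (λ i → trans (lookup∘tabulate _ (σ ⟨$⟩ˡ i)) (cong (lookup v) (inverseʳ σ))))
  (tabulate∘lookup v)

∑-permute : (σ : Permutation′ n) (g : Fin n → ℕ) → ∑ (λ i → g (σ ⟨$⟩ʳ i)) ≡ ∑ g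
∑-permute σ g = sym (sum-permute g σ)

cost≡∑ : (w : Vec ℕ n) (X : Subset n) → cost w X ≡ ∑ (λ i → if lookup X i then lookup w i else 0)
cost≡∑ []      []      = refl
cost≡∑ (v ∷ w) (b ∷ X) = cong (_ +_) (cost≡∑ w X)

fibre≡∑ : (f : Vec (Fin k) n) (v : Fin k) → fibre f v ≡ ∑ (λ j → χ ⌊ lookup f j ≟ᶠ v ⌋)
fibre≡∑ []      v = refl
fibre≡∑ (u ∷ f) v with u ≟ᶠ v
... | yes _ = cong suc (fibre≡∑ f v)
... | no  _ = fibre≡∑ f v

cost-permute : (σ : Permutation′ n) (w : Vec ℕ n) (X : Subset n) → cost (permute σ w) (permute σ X) ≡ cost w X
cost-permute {n} σ w X = begin
  cost (permute σ w) (permute σ X)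
    ≡⟨ cost≡∑ (permute σ w) (permute σ X) ⟩
  ∑ (λ i → if lookup (permute σ X) i then lookup (permute σ w) i else 0)
    ≡⟨ sum-cong-≗ {n} (λ i → cong₂ (λ b v → if b then v else 0) (lookup∘tabulate _ i) (lookup∘tabulate _ i)) ⟩
  ∑ (λ i → if lookup X (σ ⟨$⟩ʳ i) then lookup w (σ ⟨$⟩ʳ i) else 0)
    ≡⟨ ∑-permute σ (λ i → if lookup X i then lookup w i else 0) ⟩
  ∑ (λ i → if lookup X i then lookup w i else 0)
    ≡⟨ cost≡∑ w X ⟨
  cost w X ∎
  where open ≡-Reasoning

fibre-permute : (σ : Permutation′ n) (f : Vec (Fin k) n) (v : Fin k) → fibre (permute σ f) v ≡ fibre f v
fibre-permute {n = n} σ f v = begin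
  fibre (permute σ f) v                                   ≡⟨ fibre≡∑ (permute σ f) v ⟩
  ∑ (λ j → χ ⌊ lookup (permute σ f) j ≟ᶠ v ⌋)
    ≡⟨ sum-cong-≗ {n} (λ j → cong (λ u → χ ⌊ u ≟ᶠ v ⌋) (lookup∘tabulate _ j)) ⟩
  ∑ (λ j → χ ⌊ lookup f (σ ⟨$⟩ʳ j) ≟ᶠ v ⌋)           ≡⟨ ∑-permute σ (λ j → χ ⌊ lookup f j ≟ᶠ v ⌋) ⟩
  ∑ (λ j → χ ⌊ lookup f j ≟ᶠ v ⌋)                    ≡⟨ fibre≡∑ f v ⟨
  fibre f v                                               ∎
  where open ≡-Reasoning

values-permute : (σ : Permutation′ n) (f : Vec (Fin k) n) → values (permute σ f) ≡ permute σ (values f)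
values-permute σ f =
  trans (sym (tabulate-∘ (suc ∘ toℕ) _)) (tabulate-cong (λ i → sym (lookup-map (σ ⟨$⟩ʳ i) (suc ∘ toℕ) f)))

IsoVia-flip : ∀ {𝓑 𝓑′ : BaseFamily n} (σ : Permutation′ n) → IsoVia σ 𝓑 𝓑′ → IsoVia (flip σ) 𝓑′ 𝓑
IsoVia-flip {𝓑 = 𝓑} σ iso B = sym (trans (iso (permute (flip σ) B)) (cong 𝓑 (permute-flip σ B)))

module _ {𝓑 𝓑′ : BaseFamily n} (σ : Permutation′ n) (iso : IsoVia σ 𝓑 𝓑′) where

  uniqueMin-iso : ∀ {w} → UniqueMin (T ∘ 𝓑′) (cost w) → UniqueMin (T ∘ 𝓑) (cost (permute σ w))
  uniqueMin-iso {w} = UniqueMin-transfer (permute σ) (permute (flip σ))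
    (λ {X} b′ → subst T (iso X) b′)
    (λ {Y} b → subst T (IsoVia-flip σ iso Y) b)
    (λ {Y} _ → permute-flip σ Y)
    (λ {X} {X′} _ _ lt → subst₂ _<_ (sym (cost-permute σ w X)) (sym (cost-permute σ w X′)) lt)

  contributes-iso : (a : Vec ℕ k) (g : Vec (Fin k) n) → T (contributes 𝓑′ a g) → T (contributes 𝓑 a (permute σ g))
  contributes-iso a g t with Equivalence.to (contributes⇔ 𝓑′ a g) t
  ... | generic , fibres = Equivalence.from (contributes⇔ 𝓑 a (permute σ g))
    ( subst (UniqueMin (T ∘ 𝓑) ∘ cost) (sym (values-permute σ g)) (uniqueMin-iso {values g} generic)
    , λ i → trans (fibre-permute σ g i) (fibres i))

coeffF-iso : ∀ {𝓑 𝓑′ : BaseFamily n} (σ : Permutation′ n) → IsoVia σ 𝓑 𝓑′ →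
             (k : ℕ) (a : Vec ℕ k) → coeffF 𝓑 k a ≡ coeffF 𝓑′ k a
coeffF-iso {n} {𝓑} {𝓑′} σ iso k a =
  length-filterᵇ-image (contributes 𝓑 a) (permute σ) (allFuns-unique n k) allFuns-complete
    (contributing-unique 𝓑′ a) permute-injective image
  where
  permute-injective : ∀ {f g} → permute σ f ≡ permute σ g → f ≡ g
  permute-injective {f} {g} eq = trans (sym (flip-permute σ f)) (trans (cong (permute (flip σ)) eq) (flip-permute σ g))
  image : ∀ f → T (contributes 𝓑 a f) ⇔ (∃ λ g → g ∈ₗ contributing 𝓑′ a × permute σ g ≡ f)
  image f = mk⇔
    (λ t → permute (flip σ) f ,
           Equivalence.from (∈-contributing⇔ 𝓑′ a) (contributes-iso (flip σ) (IsoVia-flip σ iso) a f t) ,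
           permute-flip σ f)
    (λ { (g , g∈ , refl) → contributes-iso σ iso a g (Equivalence.to (∈-contributing⇔ 𝓑′ a) g∈) })

-- Unit and counit

allZero⇔ : (a : Vec ℕ k) → T (allZero a) ⇔ (∀ i → lookup a i ≡ 0)
allZero⇔ []      = mk⇔ (λ _ ()) (λ _ → _)
allZero⇔ (x ∷ a) = mk⇔
  (λ t → let (x≡0 , rest) = Equivalence.to T-∧ t in
         λ { zero → ℕ.≡ᵇ⇒≡ x 0 x≡0 ; (suc i) → Equivalence.to (allZero⇔ a) rest i })
  (λ h → Equivalence.from T-∧ (ℕ.≡⇒≡ᵇ x 0 (h zero) , Equivalence.from (allZero⇔ a) (h ∘ suc)))

uniqueMin-Subset0 : {P : Subset 0 → Set} {c : Subset 0 → ℕ} → ∃ P → UniqueMin P c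
uniqueMin-Subset0 ([] , p) = [] , p , λ { [] _ []≢[] → contradiction refl []≢[] }

contributes-Subset0 : (𝓑 : BaseFamily 0) (a : Vec ℕ k) → ∃ (T ∘ 𝓑) → contributes 𝓑 a [] ≡ allZero a
contributes-Subset0 𝓑 a base = T-injective (mk⇔
  (λ t → Equivalence.from (allZero⇔ a) (λ i → sym (proj₂ (Equivalence.to (contributes⇔ 𝓑 a []) t) i)))
  (λ t → Equivalence.from (contributes⇔ 𝓑 a []) (uniqueMin-Subset0 base , λ i → sym (Equivalence.to (allZero⇔ a) t i))))

coeffF-Subset0 : (𝓑 : BaseFamily 0) → ∃ (T ∘ 𝓑) → (k : ℕ) (a : Vec ℕ k) → coeffF 𝓑 k a ≡ χ (allZero a)
coeffF-Subset0 𝓑 base k a = begin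
  coeffF 𝓑 k a                       ≡⟨ length-filterᵇ-∷ (contributes 𝓑 a) [] [] ⟩
  χ (contributes 𝓑 a []) + 0         ≡⟨ ℕ.+-identityʳ _ ⟩
  χ (contributes 𝓑 a [])             ≡⟨ cong χ (contributes-Subset0 𝓑 a base) ⟩
  χ (allZero a)                      ∎
  where open ≡-Reasoning

coeffF-emptyBases : (k : ℕ) (a : Vec ℕ k) → coeffF emptyBases k a ≡ (if allZero a then 1 else 0)
coeffF-emptyBases = coeffF-Subset0 emptyBases ([] , _)

allFuns-into-Fin0 : ∀ n → allFuns (suc n) 0 ≡ []
allFuns-into-Fin0 n = go (allFuns n 0)
  where
  go : (fs : List (Vec (Fin 0) n)) → consAll (allFin 0) fs ≡ []
  go []       = refl
  go (_ ∷ fs) = go fs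

coeffF-constantTerm : (M : Matroid n) → coeffF (isBase M) 0 [] ≡ (if n ≡ᵇ 0 then 1 else 0)
coeffF-constantTerm {zero}  M = coeffF-Subset0 (isBase M) (nonempty M) 0 []
coeffF-constantTerm {suc n} M = cong (length ∘ filterᵇ (contributes (isBase M) [])) (allFuns-into-Fin0 n)

-- Product: direct sums

take-drop-++ : (xs : Vec S n₁) (ys : Vec S n₂) → take n₁ (xs ++ ys) ≡ xs × drop n₁ (xs ++ ys) ≡ ys
take-drop-++ {n₁ = n₁} xs ys = ++-injective _ xs (take++drop≡id n₁ (xs ++ ys))

cost-++ : (w₁ : Vec ℕ n₁) (w₂ : Vec ℕ n₂) (X₁ : Subset n₁) (X₂ : Subset n₂) →
          cost (w₁ ++ w₂) (X₁ ++ X₂) ≡ cost w₁ X₁ + cost w₂ X₂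
cost-++ []       w₂ []       X₂ = refl
cost-++ (v ∷ w₁) w₂ (b ∷ X₁) X₂ =
  trans (cong (_ +_) (cost-++ w₁ w₂ X₁ X₂)) (sym (ℕ.+-assoc (if b then v else 0) (cost w₁ X₁) (cost w₂ X₂)))

cost-take-drop : (w₁ : Vec ℕ n₁) (w₂ : Vec ℕ n₂) (X : Subset (n₁ + n₂)) →
                 cost (w₁ ++ w₂) X ≡ cost w₁ (take n₁ X) + cost w₂ (drop n₁ X)
cost-take-drop {n₁} w₁ w₂ X = trans (cong (cost (w₁ ++ w₂)) (sym (take++drop≡id n₁ X))) (cost-++ w₁ w₂ _ _)

fibre-++ : (f₁ : Vec (Fin k) n₁) (f₂ : Vec (Fin k) n₂) (i : Fin k) → fibre (f₁ ++ f₂) i ≡ fibre f₁ i + fibre f₂ i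
fibre-++ []       f₂ i = refl
fibre-++ (v ∷ f₁) f₂ i with v ≟ᶠ i
... | yes _ = cong suc (fibre-++ f₁ f₂ i)
... | no  _ = fibre-++ f₁ f₂ i

module _ (𝓑₁ : BaseFamily n₁) (𝓑₂ : BaseFamily n₂) where

  private
    𝓑 = directSumBases 𝓑₁ 𝓑₂

  directSum-base⇔ : (X₁ : Subset n₁) (X₂ : Subset n₂) → T (𝓑 (X₁ ++ X₂)) ⇔ (T (𝓑₁ X₁) × T (𝓑₂ X₂))
  directSum-base⇔ X₁ X₂ with take-drop-++ X₁ X₂
  ... | take≡ , drop≡ = subst (λ (Y₁ , Y₂) → T (𝓑₁ Y₁ ∧ 𝓑₂ Y₂) ⇔ (T (𝓑₁ X₁) × T (𝓑₂ X₂))) (sym (cong₂ _,_ take≡ drop≡)) T-∧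

  uniqueMin-⊕⇒ : ∀ {w₁ w₂} → UniqueMin (T ∘ 𝓑) (cost (w₁ ++ w₂)) →
                 UniqueMin (T ∘ 𝓑₁) (cost w₁) × UniqueMin (T ∘ 𝓑₂) (cost w₂)
  uniqueMin-⊕⇒ {w₁} {w₂} (B , b , unique) = (B₁ , b₁ , unique₁) , (B₂ , b₂ , unique₂)
    where
    B₁ = take n₁ B
    B₂ = drop n₁ B
    b₁ = proj₁ (Equivalence.to T-∧ b)
    b₂ = proj₂ (Equivalence.to T-∧ b)
    cost-B = cost-take-drop w₁ w₂ B
    unique₁ : ∀ B₁′ → T (𝓑₁ B₁′) → B₁′ ≢ B₁ → cost w₁ B₁ < cost w₁ B₁′
    unique₁ B₁′ b₁′ B₁′≢B₁ = ℕ.+-cancelʳ-< (cost w₂ B₂) _ _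
      (subst₂ _<_ cost-B (cost-++ w₁ w₂ B₁′ B₂)
        (unique (B₁′ ++ B₂) (Equivalence.from (directSum-base⇔ B₁′ B₂) (b₁′ , b₂))
          (λ eq → B₁′≢B₁ (++-injectiveˡ B₁′ B₁ (trans eq (sym (take++drop≡id n₁ B)))))))
    unique₂ : ∀ B₂′ → T (𝓑₂ B₂′) → B₂′ ≢ B₂ → cost w₂ B₂ < cost w₂ B₂′
    unique₂ B₂′ b₂′ B₂′≢B₂ = ℕ.+-cancelˡ-< (cost w₁ B₁) _ _
      (subst₂ _<_ cost-B (cost-++ w₁ w₂ B₁ B₂′)
        (unique (B₁ ++ B₂′) (Equivalence.from (directSum-base⇔ B₁ B₂′) (b₁ , b₂′))
          (λ eq → B₂′≢B₂ (++-injectiveʳ B₁ B₁ (trans eq (sym (take++drop≡id n₁ B)))))))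

  uniqueMin-⊕⇐ : ∀ {w₁ w₂} → UniqueMin (T ∘ 𝓑₁) (cost w₁) → UniqueMin (T ∘ 𝓑₂) (cost w₂) →
                 UniqueMin (T ∘ 𝓑) (cost (w₁ ++ w₂))
  uniqueMin-⊕⇐ {w₁} {w₂} min₁@(B₁ , b₁ , unique₁) min₂@(B₂ , b₂ , unique₂) =
    B₁ ++ B₂ , Equivalence.from (directSum-base⇔ B₁ B₂) (b₁ , b₂) , unique
    where
    unique : ∀ B′ → T (𝓑 B′) → B′ ≢ B₁ ++ B₂ → cost (w₁ ++ w₂) (B₁ ++ B₂) < cost (w₁ ++ w₂) B′
    unique B′ b′ B′≢B = subst₂ _<_ (sym (cost-++ w₁ w₂ B₁ B₂)) (sym (cost-take-drop w₁ w₂ B′))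
      (cheaper (take n₁ B′ ≟ˢ B₁) (drop n₁ B′ ≟ˢ B₂))
      where
      b₁′ = proj₁ (Equivalence.to T-∧ b′)
      b₂′ = proj₂ (Equivalence.to T-∧ b′)
      cheaper : Dec (take n₁ B′ ≡ B₁) → Dec (drop n₁ B′ ≡ B₂) →
                cost w₁ B₁ + cost w₂ B₂ < cost w₁ (take n₁ B′) + cost w₂ (drop n₁ B′)
      cheaper (yes B₁′≡B₁) (yes B₂′≡B₂) = contradiction (trans (sym (take++drop≡id n₁ B′)) (cong₂ _++_ B₁′≡B₁ B₂′≡B₂)) B′≢B
      cheaper (no B₁′≢B₁)  _            = ℕ.+-mono-<-≤ (unique₁ _ b₁′ B₁′≢B₁) (uniqueMin-≤ min₂ _ b₂′)
      cheaper (yes _)      (no B₂′≢B₂)  = ℕ.+-mono-≤-< (uniqueMin-≤ min₁ _ b₁′) (unique₂ _ b₂′ B₂′≢B₂)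

firstFibres : ∀ n₁ {n₂} → Vec (Fin k) (n₁ + n₂) → Vec ℕ k
firstFibres n₁ f = tabulate (fibre (take n₁ f))

fibre-take-drop : ∀ n₁ {n₂} (f : Vec (Fin k) (n₁ + n₂)) (i : Fin k) → fibre f i ≡ fibre (take n₁ f) i + fibre (drop n₁ f) i
fibre-take-drop n₁ f i = trans (cong (λ g → fibre g i) (sym (take++drop≡id n₁ f))) (fibre-++ (take n₁ f) _ i)

firstFibres-≤ : ∀ n₁ {n₂} (f : Vec (Fin k) (n₁ + n₂)) {a : Vec ℕ k} → (∀ i → fibre f i ≡ lookup a i) →
                ∀ i → lookup (firstFibres n₁ f) i ≤ lookup a i
firstFibres-≤ n₁ f {a} fibres i = begin
  lookup (firstFibres n₁ f) i                 ≡⟨ lookup∘tabulate _ i ⟩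
  fibre (take n₁ f) i                         ≤⟨ ℕ.m≤m+n _ _ ⟩
  fibre (take n₁ f) i + fibre (drop n₁ f) i   ≡⟨ fibre-take-drop n₁ f i ⟨
  fibre f i                                   ≡⟨ fibres i ⟩
  lookup a i                                  ∎
  where open ℕ.≤-Reasoning

private
  _≟ᵛ_ : (a b : Vec ℕ k) → Dec (a ≡ b)
  _≟ᵛ_ = ≡-dec ℕ._≟_

module _ (𝓑₁ : BaseFamily n₁) (𝓑₂ : BaseFamily n₂) {a b : Vec ℕ k} (b≤a : ∀ i → lookup b i ≤ lookup a i) where

  private
    𝓑 = directSumBases 𝓑₁ 𝓑₂

  contributes-⊕⇔ : (f₁ : Vec (Fin k) n₁) (f₂ : Vec (Fin k) n₂) →
    T (contributes 𝓑 a (f₁ ++ f₂) ∧ ⌊ firstFibres n₁ (f₁ ++ f₂) ≟ᵛ b ⌋) ⇔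
    (T (contributes 𝓑₁ b f₁) × T (contributes 𝓑₂ (zipWith _∸_ a b) f₂))
  contributes-⊕⇔ f₁ f₂ = mk⇔ to from
    where
    take≡ = proj₁ (take-drop-++ f₁ f₂)
    fibre₁ : ∀ i → lookup (firstFibres n₁ (f₁ ++ f₂)) i ≡ fibre f₁ i
    fibre₁ i = trans (lookup∘tabulate _ i) (cong (λ g → fibre g i) take≡)
    values≡ : values (f₁ ++ f₂) ≡ values f₁ ++ values f₂
    values≡ = map-++ _ f₁ f₂
    to : T (contributes 𝓑 a (f₁ ++ f₂) ∧ ⌊ firstFibres n₁ (f₁ ++ f₂) ≟ᵛ b ⌋) →
         T (contributes 𝓑₁ b f₁) × T (contributes 𝓑₂ (zipWith _∸_ a b) f₂)
    to t with Equivalence.to T-∧ t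
    ... | t₁ , t₂ with Equivalence.to (contributes⇔ 𝓑 a (f₁ ++ f₂)) t₁ | toWitness {a? = firstFibres n₁ (f₁ ++ f₂) ≟ᵛ b} t₂
    ...   | generic , fibres | firstFibres≡b =
      Equivalence.from (contributes⇔ 𝓑₁ b f₁) (proj₁ generic′ , fib₁) ,
      Equivalence.from (contributes⇔ 𝓑₂ (zipWith _∸_ a b) f₂) (proj₂ generic′ , fib₂)
      where
      generic′ = uniqueMin-⊕⇒ 𝓑₁ 𝓑₂ {values f₁} {values f₂} (subst (UniqueMin (T ∘ 𝓑) ∘ cost) values≡ generic)
      fib₁ : ∀ i → fibre f₁ i ≡ lookup b i
      fib₁ i = trans (sym (fibre₁ i)) (cong (λ v → lookup v i) firstFibres≡b)
      fib₂ : ∀ i → fibre f₂ i ≡ lookup (zipWith _∸_ a b) i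
      fib₂ i = begin
        fibre f₂ i                              ≡⟨ ℕ.m+n∸m≡n (fibre f₁ i) (fibre f₂ i) ⟨
        fibre f₁ i + fibre f₂ i ∸ fibre f₁ i    ≡⟨ cong₂ _∸_ (trans (sym (fibre-++ f₁ f₂ i)) (fibres i)) (fib₁ i) ⟩
        lookup a i ∸ lookup b i                 ≡⟨ lookup-zipWith _∸_ i a b ⟨
        lookup (zipWith _∸_ a b) i              ∎
        where open ≡-Reasoning
    from : T (contributes 𝓑₁ b f₁) × T (contributes 𝓑₂ (zipWith _∸_ a b) f₂) →
           T (contributes 𝓑 a (f₁ ++ f₂) ∧ ⌊ firstFibres n₁ (f₁ ++ f₂) ≟ᵛ b ⌋)
    from (t₁ , t₂) with Equivalence.to (contributes⇔ 𝓑₁ b f₁) t₁ | Equivalence.to (contributes⇔ 𝓑₂ (zipWith _∸_ a b) f₂) t₂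
    ... | generic₁ , fibres₁ | generic₂ , fibres₂ = Equivalence.from T-∧
      ( Equivalence.from (contributes⇔ 𝓑 a (f₁ ++ f₂))
          (subst (UniqueMin (T ∘ 𝓑) ∘ cost) (sym values≡) (uniqueMin-⊕⇐ 𝓑₁ 𝓑₂ {values f₁} {values f₂} generic₁ generic₂) ,
           fibres)
      , fromWitness {a? = firstFibres n₁ (f₁ ++ f₂) ≟ᵛ b}
          (trans (tabulate-cong λ i → trans (sym (lookup∘tabulate _ i)) (trans (fibre₁ i) (fibres₁ i))) (tabulate∘lookup b)))
      where
      fibres : ∀ i → fibre (f₁ ++ f₂) i ≡ lookup a i
      fibres i = begin
        fibre (f₁ ++ f₂) i                      ≡⟨ fibre-++ f₁ f₂ i ⟩
        fibre f₁ i + fibre f₂ i                 ≡⟨ cong₂ _+_ (fibres₁ i) (trans (fibres₂ i) (lookup-zipWith _∸_ i a b)) ⟩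
        lookup b i + (lookup a i ∸ lookup b i)  ≡⟨ ℕ.m+[n∸m]≡n (b≤a i) ⟩
        lookup a i                              ∎
        where open ≡-Reasoning

  coeffF-firstFibres : length (filterᵇ (λ f → contributes 𝓑 a f ∧ ⌊ firstFibres n₁ f ≟ᵛ b ⌋) (allFuns (n₁ + n₂) k))
                       ≡ coeffF 𝓑₁ k b * coeffF 𝓑₂ k (zipWith _∸_ a b)
  coeffF-firstFibres = trans
    (length-filterᵇ-image _ (uncurry _++_) (allFuns-unique _ k) allFuns-complete
      (Unique.cartesianProduct⁺ (contributing-unique 𝓑₁ b)
                                (contributing-unique 𝓑₂ c))
      ++-injective′ image)
    (length-cartesianProduct F₁ F₂)
    where
    c = zipWith _∸_ a b
    F₁ = contributing 𝓑₁ b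
    F₂ = contributing 𝓑₂ c
    ++-injective′ : ∀ {p q} → uncurry _++_ p ≡ uncurry _++_ q → p ≡ q
    ++-injective′ {f₁ , f₂} {g₁ , g₂} eq = cong₂ _,_ (++-injectiveˡ f₁ g₁ eq) (++-injectiveʳ f₁ g₁ eq)
    image : ∀ f → T (contributes 𝓑 a f ∧ ⌊ firstFibres n₁ f ≟ᵛ b ⌋) ⇔
                  (∃ λ p → p ∈ₗ cartesianProduct F₁ F₂ × uncurry _++_ p ≡ f)
    image f = mk⇔
      (λ t → let (t₁ , t₂) = Equivalence.to (contributes-⊕⇔ (take n₁ f) (drop n₁ f))
                                 (subst (λ g → T (contributes 𝓑 a g ∧ ⌊ firstFibres n₁ g ≟ᵛ b ⌋)) (sym (take++drop≡id n₁ f)) t)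
             in (take n₁ f , drop n₁ f) ,
                ∈-cartesianProduct⁺ (Equivalence.from (∈-contributing⇔ 𝓑₁ b) t₁)
                                    (Equivalence.from (∈-contributing⇔ 𝓑₂ c) t₂) ,
                take++drop≡id n₁ f)
      (λ { ((f₁ , f₂) , p∈ , refl) →
           let (f₁∈ , f₂∈) = ∈-cartesianProduct⁻ F₁ F₂ p∈
           in Equivalence.from (contributes-⊕⇔ f₁ f₂)
                (Equivalence.to (∈-contributing⇔ 𝓑₁ b) f₁∈ ,
                 Equivalence.to (∈-contributing⇔ 𝓑₂ c) f₂∈) })

coeffF-directSum : (𝓑₁ : BaseFamily n₁) (𝓑₂ : BaseFamily n₂) (k : ℕ) (a : Vec ℕ k) →
                   coeffF (directSumBases 𝓑₁ 𝓑₂) k a ≡ productCoeff (coeffF 𝓑₁ k) (coeffF 𝓑₂ k) a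
coeffF-directSum {n₁} {n₂} 𝓑₁ 𝓑₂ k a = begin
  coeffF 𝓑 k a
    ≡⟨ length-filterᵇ-partition _≟ᵛ_ (contributes 𝓑 a) (firstFibres n₁) (below a) (below-unique a)
         firstFibres∈below (allFuns (n₁ + n₂) k) ⟩
  sum (List.map (λ b → length (filterᵇ (λ f → contributes 𝓑 a f ∧ ⌊ firstFibres n₁ f ≟ᵛ b ⌋) (allFuns (n₁ + n₂) k)))
                (below a))
    ≡⟨ cong sum (map-cong-local (All.tabulate (λ {b} b∈ → coeffF-firstFibres 𝓑₁ 𝓑₂ {a} {b} (∈-below⁻ a b∈)))) ⟩
  productCoeff (coeffF 𝓑₁ k) (coeffF 𝓑₂ k) a
    ∎
  where
  open ≡-Reasoning
  𝓑 = directSumBases 𝓑₁ 𝓑₂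
  firstFibres∈below : ∀ f → T (contributes 𝓑 a f) → firstFibres n₁ f ∈ₗ below a
  firstFibres∈below f t = ∈-below⁺ {a = a} (firstFibres-≤ n₁ f {a} (proj₂ (Equivalence.to (contributes⇔ 𝓑 a f) t)))

-- Coproduct: restriction and contraction

module _ (M : Matroid n) where

  open MatroidTheory M
  open IsBasis

  private
    𝓑 = isBase M

  isIndep⇔ : {I : Subset n} → T (isIndep 𝓑 I) ⇔ Independent I
  isIndep⇔ {I} = mk⇔
    (λ t → let (B , t′) = Equivalence.to (any-complete⇔ _ allSubsets-complete) t
               (b , I⊆B) = Equivalence.to T-∧ t′
           in B , b , λ {i} → ⊆ᵇ⇒⊆ I⊆B {i})
    (λ (B , b , I⊆B) → Equivalence.from (any-complete⇔ _ allSubsets-complete)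
                         (B , Equivalence.from T-∧ (b , ⊆⇒⊆ᵇ I⊆B)))

  restrictBases⇔ : (A : Subset n) (Y : Subset (size A)) → T (restrictBases 𝓑 A Y) ⇔ IsBasis A (lift A Y)
  restrictBases⇔ A Y = mk⇔ to from
    where
    Larger : Subset (size A) → Bool
    Larger Y′ = (Y ⊆ᵇ Y′) ∧ not (Y ==ˢ Y′) ∧ isIndep 𝓑 (lift A Y′)
    larger⇔ : ∀ Y′ → T (Larger Y′) ⇔ (Y ⊆ Y′ × Y ≢ Y′ × Independent (lift A Y′))
    larger⇔ Y′ = mk⇔
      (λ t → let (s , t′) = Equivalence.to T-∧ t ; (ne , ind) = Equivalence.to T-∧ t′ in
        (λ {i} → ⊆ᵇ⇒⊆ s {i}) , Equivalence.to T-not⇔ ne ∘ Equivalence.from ==ˢ⇔ , Equivalence.to isIndep⇔ ind)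
      (λ (s , ne , ind) → Equivalence.from T-∧ (⊆⇒⊆ᵇ s ,
        Equivalence.from T-∧ (Equivalence.from T-not⇔ (ne ∘ Equivalence.to ==ˢ⇔) , Equivalence.from isIndep⇔ ind)))
    to : T (restrictBases 𝓑 A Y) → IsBasis A (lift A Y)
    to t = record
      { ⊆A          = lift-⊆ A Y
      ; independent = Equivalence.to isIndep⇔ (proj₁ (Equivalence.to T-∧ t))
      ; maximal     = maximal′
      }
      where
      no-larger : ¬ ∃ (T ∘ Larger)
      no-larger = Equivalence.to T-not⇔ (proj₂ (Equivalence.to T-∧ t))
                ∘ Equivalence.from (any-complete⇔ _ allSubsets-complete)
      maximal′ : ∀ {Z} → lift A Y ⊆ Z → Z ⊆ A → Independent Z → Z ≡ lift A Y
      maximal′ {Z} Y⊆Z Z⊆A ind with Y ≟ˢ restrict A Z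
      ... | yes Y≡Z′ = trans (sym (lift-restrict A Z⊆A)) (cong (lift A) (sym Y≡Z′))
      ... | no  Y≢Z′ = contradiction (restrict A Z , Equivalence.from (larger⇔ (restrict A Z))
              (lift-mono⁻ A (subst (lift A Y ⊆_) (sym (lift-restrict A Z⊆A)) Y⊆Z) , Y≢Z′ ,
               subst Independent (sym (lift-restrict A Z⊆A)) ind)) no-larger
    from : IsBasis A (lift A Y) → T (restrictBases 𝓑 A Y)
    from Y-basis = Equivalence.from T-∧
      (Equivalence.from isIndep⇔ (independent Y-basis) ,
       Equivalence.from T-not⇔ (no-larger ∘ Equivalence.to (any-complete⇔ _ allSubsets-complete)))
      where
      no-larger : ¬ ∃ (T ∘ Larger)
      no-larger (Y′ , larger) with Equivalence.to (larger⇔ Y′) larger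
      ... | Y⊆Y′ , Y≢Y′ , ind = Y≢Y′ (begin
        Y                               ≡⟨ restrict-lift A Y ⟨
        restrict A (lift A Y)           ≡⟨ cong (restrict A) (maximal Y-basis (lift-mono A Y⊆Y′) (lift-⊆ A Y′) ind) ⟨
        restrict A (lift A Y′)          ≡⟨ restrict-lift A Y′ ⟩
        Y′                              ∎)
        where open ≡-Reasoning

  contractBases⇔ : (A : Subset n) (X : Subset (size (∁ A))) →
                   T (contractBases 𝓑 A X) ⇔ IsContractionBase A (lift (∁ A) X)
  contractBases⇔ A X = mk⇔
    (λ t → let (Y , t′) = Equivalence.to (any-complete⇔ _ allSubsets-complete) t
               (rb , b) = Equivalence.to T-∧ t′
           in (λ {i} → lift-∁-disjoint A X {i}) , lift A Y , Equivalence.to (restrictBases⇔ A Y) rb , b)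
    (λ (_ , Y₀ , Y₀-basis , b) →
       let Y₀≡ = lift-restrict A (⊆A Y₀-basis)
       in Equivalence.from (any-complete⇔ _ allSubsets-complete)
            (restrict A Y₀ , Equivalence.from T-∧
              (Equivalence.from (restrictBases⇔ A (restrict A Y₀)) (subst (IsBasis A) (sym Y₀≡) Y₀-basis) ,
               subst (λ Z → Base (lift (∁ A) X ∪ Z)) (sym Y₀≡) b)))

  uniqueMin-restriction⇔ : (A : Subset n) (w : Vec ℕ n) →
                           UniqueMin (IsBasis A) (cost w) ⇔ UniqueMin (T ∘ restrictBases 𝓑 A) (cost (restrict A w))
  uniqueMin-restriction⇔ A w = mk⇔
    (UniqueMin-transfer (restrict A) (lift A) restricted (Equivalence.to (restrictBases⇔ A _)) (λ _ → restrict-lift A _)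
      (λ X-basis X′-basis → subst₂ _<_ (cost-via X-basis) (cost-via X′-basis)))
    (UniqueMin-transfer (lift A) (restrict A) (Equivalence.to (restrictBases⇔ A _)) restricted
      (λ X-basis → lift-restrict A (⊆A X-basis))
      (λ {Y} {Y′} _ _ → subst₂ _<_ (sym (cost-lift w A Y)) (sym (cost-lift w A Y′))))
    where
    restricted : ∀ {X} → IsBasis A X → T (restrictBases 𝓑 A (restrict A X))
    restricted X-basis =
      Equivalence.from (restrictBases⇔ A _) (subst (IsBasis A) (sym (lift-restrict A (⊆A X-basis))) X-basis)
    cost-via : ∀ {X} → IsBasis A X → cost w X ≡ cost (restrict A w) (restrict A X)
    cost-via {X} X-basis = trans (cong (cost w) (sym (lift-restrict A (⊆A X-basis)))) (cost-lift w A (restrict A X))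

  -- Off A the weights are those of wh raised by c; since all bases of M/A have the same size, the
  -- shift does not change which of them is cheapest.
  module _ (A : Subset n) {w : Vec ℕ n} {c : ℕ} {wh : Vec ℕ (size (∁ A))} (w≡ : restrict (∁ A) w ≡ Vec.map (c +_) wh) where

    private
      ⊆∁A : ∀ {X} → IsContractionBase A X → X ⊆ ∁ A
      ⊆∁A X-cb i∈X = x∉p⇒x∈∁p (proj₁ X-cb i∈X)
      contracted : ∀ {X} → IsContractionBase A X → T (contractBases 𝓑 A (restrict (∁ A) X))
      contracted X-cb = Equivalence.from (contractBases⇔ A _)
        (subst (IsContractionBase A) (sym (lift-restrict (∁ A) (⊆∁A X-cb))) X-cb)
      cost-lift∁ : ∀ Y → cost w (lift (∁ A) Y) ≡ c * size (lift (∁ A) Y) + cost wh Y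
      cost-lift∁ Y = begin
        cost w (lift (∁ A) Y)                   ≡⟨ cost-lift w (∁ A) Y ⟩
        cost (restrict (∁ A) w) Y               ≡⟨ cong (λ v → cost v Y) w≡ ⟩
        cost (Vec.map (c +_) wh) Y                  ≡⟨ cost-shift c wh Y ⟩
        c * size Y + cost wh Y                  ≡⟨ cong (λ s → c * s + cost wh Y) (size-lift (∁ A) Y) ⟨
        c * size (lift (∁ A) Y) + cost wh Y     ∎
        where open ≡-Reasoning
      cost-cb : ∀ {X} → IsContractionBase A X → cost w X ≡ c * size X + cost wh (restrict (∁ A) X)
      cost-cb {X} X-cb = subst (λ Z → cost w Z ≡ c * size Z + cost wh (restrict (∁ A) X))
        (lift-restrict (∁ A) (⊆∁A X-cb)) (cost-lift∁ (restrict (∁ A) X))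

    uniqueMin-contraction⇔ : UniqueMin (IsContractionBase A) (cost w) ⇔ UniqueMin (T ∘ contractBases 𝓑 A) (cost wh)
    uniqueMin-contraction⇔ = mk⇔
      (UniqueMin-transfer (restrict (∁ A)) (lift (∁ A)) contracted (Equivalence.to (contractBases⇔ A _))
        (λ _ → restrict-lift (∁ A) _)
        (λ {X} {X′} X-cb X′-cb lt → ℕ.+-cancelˡ-< (c * size X) _ _
          (subst₂ _<_ (cost-cb X-cb)
            (trans (cost-cb X′-cb) (cong (λ s → c * s + _) (sym (contraction-size X-cb X′-cb)))) lt)))
      (UniqueMin-transfer (lift (∁ A)) (restrict (∁ A)) (Equivalence.to (contractBases⇔ A _)) contracted
        (λ X-cb → lift-restrict (∁ A) (⊆∁A X-cb))
        (λ {Y} {Y′} t t′ lt → subst₂ _<_ (sym (cost-lift∁ Y))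
          (sym (trans (cost-lift∁ Y′) (cong (λ s → c * s + cost wh Y′)
            (sym (contraction-size (Equivalence.to (contractBases⇔ A Y) t) (Equivalence.to (contractBases⇔ A Y′) t′))))))
          (ℕ.+-monoʳ-< (c * size (lift (∁ A) Y)) lt)))

isLow : ∀ k m → Fin (k + m) → Bool
isLow k m v = [ const true , const false ]′ (splitAt k v)

lowSet : ∀ k m → Vec (Fin (k + m)) n → Subset n
lowSet k m = Vec.map (isLow k m)

module _ {k m : ℕ} where

  merge : (A : Subset n) → Vec (Fin k) (size A) → Vec (Fin m) (size (∁ A)) → Vec (Fin (k + m)) n
  merge []          []      []      = []
  merge (true ∷ A)  (x ∷ g) h       = (x ↑ˡ m) ∷ merge A g h
  merge (false ∷ A) g       (y ∷ h) = (k ↑ʳ y) ∷ merge A g h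

  merge-surjective : (f : Vec (Fin (k + m)) n) → ∃₂ λ g h → merge (lowSet k m f) g h ≡ f
  merge-surjective []      = [] , [] , refl
  merge-surjective (v ∷ f) with splitAt k v in eq | merge-surjective f
  ... | inj₁ x | g , h , f≡ = x ∷ g , h , cong₂ _∷_ (splitAt⁻¹-↑ˡ eq) f≡
  ... | inj₂ y | g , h , f≡ = g , y ∷ h , cong₂ _∷_ (splitAt⁻¹-↑ʳ eq) f≡

  lowSet-merge : (A : Subset n) (g : Vec (Fin k) (size A)) (h : Vec (Fin m) (size (∁ A))) →
      lowSet k m (merge A g h) ≡ A
  lowSet-merge []          []      []      = refl
  lowSet-merge (true ∷ A)  (x ∷ g) h       =
    cong₂ _∷_ (cong [ const true , const false ]′ (splitAt-↑ˡ k x m)) (lowSet-merge A g h)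
  lowSet-merge (false ∷ A) g       (y ∷ h) =
    cong₂ _∷_ (cong [ const true , const false ]′ (splitAt-↑ʳ k m y)) (lowSet-merge A g h)

  merge-injective : (A : Subset n) {g g′ : Vec (Fin k) (size A)} {h h′ : Vec (Fin m) (size (∁ A))} →
                    merge A g h ≡ merge A g′ h′ → g ≡ g′ × h ≡ h′
  merge-injective []          {[]}    {[]}     {[]}    {[]}     _  = refl , refl
  merge-injective (true ∷ A)  {x ∷ g} {x′ ∷ g′} eq with ∷-injective eq
  ... | x≡ , rest = Product.map₁ (cong₂ _∷_ (↑ˡ-injective m x x′ x≡)) (merge-injective A rest)
  merge-injective (false ∷ A) {h = y ∷ h} {y′ ∷ h′} eq with ∷-injective eq
  ... | y≡ , rest = Product.map₂ (cong₂ _∷_ (↑ʳ-injective k y y′ y≡)) (merge-injective A rest)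

  restrict-values-merge : (A : Subset n) (g : Vec (Fin k) (size A)) (h : Vec (Fin m) (size (∁ A))) →
      restrict A (values (merge A g h)) ≡ values g
  restrict-values-merge []          []      []      = refl
  restrict-values-merge (true ∷ A)  (x ∷ g) h       = cong₂ _∷_ (cong suc (toℕ-↑ˡ x m)) (restrict-values-merge A g h)
  restrict-values-merge (false ∷ A) g       (y ∷ h) = restrict-values-merge A g h

  restrict∁-values-merge : (A : Subset n) (g : Vec (Fin k) (size A)) (h : Vec (Fin m) (size (∁ A))) →
      restrict (∁ A) (values (merge A g h)) ≡ Vec.map (k +_) (values h)
  restrict∁-values-merge []          []      []      = refl
  restrict∁-values-merge (true ∷ A)  (x ∷ g) h       = restrict∁-values-merge A g h
  restrict∁-values-merge (false ∷ A) g       (y ∷ h) =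
    cong₂ _∷_ (trans (cong suc (toℕ-↑ʳ k y)) (sym (ℕ.+-suc k (toℕ y)))) (restrict∁-values-merge A g h)

  merge-sublevel : (A : Subset n) (g : Vec (Fin k) (size A)) (h : Vec (Fin m) (size (∁ A))) →
      IsSublevel (values (merge A g h)) k A
  merge-sublevel A g h = low A g h , high A g h
    where
    low : ∀ {n} (A : Subset n) (g : Vec (Fin k) (size A)) (h : Vec (Fin m) (size (∁ A))) {i} →
        i ∈ A → lookup (values (merge A g h)) i ≤ k
    low (true ∷ A)  (x ∷ g) h       here       = subst (_≤ k) (sym (cong suc (toℕ-↑ˡ x m))) (toℕ<n x)
    low (true ∷ A)  (x ∷ g) h       (there i∈) = low A g h i∈
    low (false ∷ A) g       (y ∷ h) (there i∈) = low A g h i∈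
    high : ∀ {n} (A : Subset n) (g : Vec (Fin k) (size A)) (h : Vec (Fin m) (size (∁ A))) {i} →
        i ∉ A → k < lookup (values (merge A g h)) i
    high (true ∷ A)  (x ∷ g) h       {zero}  i∉ = contradiction here i∉
    high (true ∷ A)  (x ∷ g) h       {suc i} i∉ = high A g h (i∉ ∘ there)
    high (false ∷ A) g       (y ∷ h) {zero}  i∉ = s≤s (subst (k ≤_) (sym (toℕ-↑ʳ k y)) (ℕ.m≤m+n k (toℕ y)))
    high (false ∷ A) g       (y ∷ h) {suc i} i∉ = high A g h (i∉ ∘ there)

  fibre-merge-↑ˡ : (A : Subset n) (g : Vec (Fin k) (size A)) (h : Vec (Fin m) (size (∁ A))) (x : Fin k) →
      fibre (merge A g h) (x ↑ˡ m) ≡ fibre g x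
  fibre-merge-↑ˡ []          []       []      x = refl
  fibre-merge-↑ˡ (true ∷ A)  (x′ ∷ g) h       x with (x′ ↑ˡ m) ≟ᶠ (x ↑ˡ m) | x′ ≟ᶠ x
  ... | yes _  | yes _   = cong suc (fibre-merge-↑ˡ A g h x)
  ... | no  _  | no  _   = fibre-merge-↑ˡ A g h x
  ... | yes eq | no x′≢x = contradiction (↑ˡ-injective m x′ x eq) x′≢x
  ... | no ne  | yes refl = contradiction refl ne
  fibre-merge-↑ˡ (false ∷ A) g        (y ∷ h) x with (k ↑ʳ y) ≟ᶠ (x ↑ˡ m)
  ... | yes eq = contradiction (trans (sym (splitAt-↑ʳ k m y)) (trans (cong (splitAt k) eq) (splitAt-↑ˡ k x m))) λ ()
  ... | no  _  = fibre-merge-↑ˡ A g h x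

  fibre-merge-↑ʳ : (A : Subset n) (g : Vec (Fin k) (size A)) (h : Vec (Fin m) (size (∁ A))) (y : Fin m) →
      fibre (merge A g h) (k ↑ʳ y) ≡ fibre h y
  fibre-merge-↑ʳ []          []      []       y = refl
  fibre-merge-↑ʳ (true ∷ A)  (x ∷ g) h        y with (x ↑ˡ m) ≟ᶠ (k ↑ʳ y)
  ... | yes eq = contradiction (trans (sym (splitAt-↑ˡ k x m)) (trans (cong (splitAt k) eq) (splitAt-↑ʳ k m y))) λ ()
  ... | no  _  = fibre-merge-↑ʳ A g h y
  fibre-merge-↑ʳ (false ∷ A) g       (y′ ∷ h) y with (k ↑ʳ y′) ≟ᶠ (k ↑ʳ y) | y′ ≟ᶠ y
  ... | yes _  | yes _    = cong suc (fibre-merge-↑ʳ A g h y)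
  ... | no  _  | no  _    = fibre-merge-↑ʳ A g h y
  ... | yes eq | no y′≢y  = contradiction (↑ʳ-injective k y′ y eq) y′≢y
  ... | no ne  | yes refl = contradiction refl ne

module _ {n : ℕ} (M : Matroid n) {k m : ℕ} (a : Vec ℕ k) (b : Vec ℕ m) where

  open MatroidTheory M

  private
    𝓑 = isBase M

  fibres-merge⇔ : (A : Subset n) (g : Vec (Fin k) (size A)) (h : Vec (Fin m) (size (∁ A))) →
    (∀ i → fibre (merge A g h) i ≡ lookup (a ++ b) i) ⇔ ((∀ x → fibre g x ≡ lookup a x) × (∀ y → fibre h y ≡ lookup b y))
  fibres-merge⇔ A g h = mk⇔
    (λ fibres → (λ x → trans (sym (fibre-merge-↑ˡ A g h x)) (trans (fibres (x ↑ˡ m)) (lookup-++ˡ a b x))) ,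
                (λ y → trans (sym (fibre-merge-↑ʳ A g h y)) (trans (fibres (k ↑ʳ y)) (lookup-++ʳ a b y))))
    (λ (fibres₁ , fibres₂) i → subst (λ j → fibre (merge A g h) j ≡ lookup (a ++ b) j) (join-splitAt k m i)
       (by-side fibres₁ fibres₂ (splitAt k i)))
    where
    by-side : (∀ x → fibre g x ≡ lookup a x) → (∀ y → fibre h y ≡ lookup b y) →
              ∀ s → fibre (merge A g h) (join k m s) ≡ lookup (a ++ b) (join k m s)
    by-side fibres₁ _ (inj₁ x) = trans (fibre-merge-↑ˡ A g h x) (trans (fibres₁ x) (sym (lookup-++ˡ a b x)))
    by-side _ fibres₂ (inj₂ y) = trans (fibre-merge-↑ʳ A g h y) (trans (fibres₂ y) (sym (lookup-++ʳ a b y)))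

  generic-merge⇔ : (A : Subset n) (g : Vec (Fin k) (size A)) (h : Vec (Fin m) (size (∁ A))) →
    UniqueMin Base (cost (values (merge A g h))) ⇔
    (UniqueMin (T ∘ restrictBases 𝓑 A) (cost (values g)) × UniqueMin (T ∘ contractBases 𝓑 A) (cost (values h)))
  generic-merge⇔ A g h = mk⇔
    (λ generic → let (basis-min , contraction-min) = uniqueMin-split {w} {k} {A} sublevel generic in
       subst (UniqueMin (T ∘ restrictBases 𝓑 A) ∘ cost) (restrict-values-merge A g h)
         (Equivalence.to (uniqueMin-restriction⇔ M A w) basis-min) ,
       Equivalence.to (uniqueMin-contraction⇔ M A {w} {k} {values h} (restrict∁-values-merge A g h)) contraction-min)
    (λ (restriction-min , contraction-min) → uniqueMin-merge {w} {k} {A} sublevel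
       (Equivalence.from (uniqueMin-restriction⇔ M A w)
         (subst (UniqueMin (T ∘ restrictBases 𝓑 A) ∘ cost) (sym (restrict-values-merge A g h)) restriction-min))
       (Equivalence.from (uniqueMin-contraction⇔ M A {w} {k} {values h} (restrict∁-values-merge A g h)) contraction-min))
    where
    w = values (merge A g h)
    sublevel : IsSublevel w k A
    sublevel = merge-sublevel A g h

  contributes-merge⇔ : (A : Subset n) (g : Vec (Fin k) (size A)) (h : Vec (Fin m) (size (∁ A))) →
    T (contributes 𝓑 (a ++ b) (merge A g h)) ⇔
    (T (contributes (restrictBases 𝓑 A) a g) × T (contributes (contractBases 𝓑 A) b h))
  contributes-merge⇔ A g h = mk⇔
    (λ t → let (generic , fibres) = Equivalence.to (contributes⇔ 𝓑 (a ++ b) (merge A g h)) t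
               (generic₁ , generic₂) = Equivalence.to (generic-merge⇔ A g h) generic
               (fibres₁ , fibres₂) = Equivalence.to (fibres-merge⇔ A g h) fibres
           in Equivalence.from (contributes⇔ _ a g) (generic₁ , fibres₁) ,
              Equivalence.from (contributes⇔ _ b h) (generic₂ , fibres₂))
    (λ (t₁ , t₂) → let (generic₁ , fibres₁) = Equivalence.to (contributes⇔ _ a g) t₁
                       (generic₂ , fibres₂) = Equivalence.to (contributes⇔ _ b h) t₂
                   in Equivalence.from (contributes⇔ 𝓑 (a ++ b) (merge A g h))
                        (Equivalence.from (generic-merge⇔ A g h) (generic₁ , generic₂) ,
                         Equivalence.from (fibres-merge⇔ A g h) (fibres₁ , fibres₂)))

  merge-preimage : ∀ f A → lowSet k m f ≡ A → T (contributes 𝓑 (a ++ b) f) →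
             ∃₂ λ g h → T (contributes (restrictBases 𝓑 A) a g) × T (contributes (contractBases 𝓑 A) b h) ×
                        merge A g h ≡ f
  merge-preimage f .(lowSet k m f) refl t = split (merge-surjective f)
    where
    split : (∃₂ λ g h → merge (lowSet k m f) g h ≡ f) →
            ∃₂ λ g h → T (contributes (restrictBases 𝓑 (lowSet k m f)) a g) ×
                       T (contributes (contractBases 𝓑 (lowSet k m f)) b h) × merge (lowSet k m f) g h ≡ f
    split (g , h , f≡) =
      let (r , c) = Equivalence.to (contributes-merge⇔ (lowSet k m f) g h) (subst (T ∘ contributes 𝓑 (a ++ b)) (sym f≡) t)
      in g , h , r , c , f≡
  coeffF-lowSet : ∀ A → length (filterᵇ (λ f → contributes 𝓑 (a ++ b) f ∧ ⌊ lowSet k m f ≟ˢ A ⌋) (allFuns n (k + m)))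
               ≡ coeffF (restrictBases 𝓑 A) k a * coeffF (contractBases 𝓑 A) m b
  coeffF-lowSet A = trans
    (length-filterᵇ-image _ (uncurry (merge A)) (allFuns-unique n (k + m)) allFuns-complete
      (Unique.cartesianProduct⁺ (contributing-unique R a)
                                (contributing-unique C b))
      (λ {(g , h)} {(g′ , h′)} eq → let (g≡ , h≡) = merge-injective A eq in cong₂ _,_ g≡ h≡)
      image)
    (length-cartesianProduct Fᴿ Fᶜ)
    where
    R = restrictBases 𝓑 A
    C = contractBases 𝓑 A
    Fᴿ = contributing R a
    Fᶜ = contributing C b
    image : ∀ f → T (contributes 𝓑 (a ++ b) f ∧ ⌊ lowSet k m f ≟ˢ A ⌋) ⇔
                  (∃ λ gh → gh ∈ₗ cartesianProduct Fᴿ Fᶜ × uncurry (merge A) gh ≡ f)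
    image f = mk⇔
      (λ t → let (t₁ , t₂) = Equivalence.to T-∧ t
                 (g , h , r , c , f≡) = merge-preimage f A (toWitness t₂) t₁
             in (g , h) ,
                ∈-cartesianProduct⁺ (Equivalence.from (∈-contributing⇔ R a) r)
                                    (Equivalence.from (∈-contributing⇔ C b) c) ,
                f≡)
      (λ { ((g , h) , gh∈ , refl) →
           let (g∈ , h∈) = ∈-cartesianProduct⁻ Fᴿ Fᶜ gh∈
           in Equivalence.from T-∧
                (Equivalence.from (contributes-merge⇔ A g h)
                   (Equivalence.to (∈-contributing⇔ R a) g∈ ,
                    Equivalence.to (∈-contributing⇔ C b) h∈) ,
                 fromWitness (lowSet-merge A g h)) })

  coeffF-coproduct : coeffF 𝓑 (k + m) (a ++ b)
                     ≡ sum (List.map (λ A → coeffF (restrictBases 𝓑 A) k a * coeffF (contractBases 𝓑 A) m b) (allSubsets n))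
  coeffF-coproduct = trans
    (length-filterᵇ-partition _≟ˢ_ (contributes 𝓑 (a ++ b)) (lowSet k m) (allSubsets n) (allSubsets-unique n)
       (λ f _ → allSubsets-complete (lowSet k m f)) (allFuns n (k + m)))
    (cong sum (map-cong coeffF-lowSet (allSubsets n)))

theorem3p1 :
  -- F is well defined as a map Mat → QSym: F(M, x) is quasisymmetric ...
  (∀ {n} (M : Matroid n) (k : ℕ) (a : Vec ℕ k) →
     coeffF (isBase M) k a ≡ coeffF (isBase M) _ (fromList (flatten a)))
  -- ... and depends only on the isomorphism class of M
  × (∀ {n} (M M' : Matroid n) (σ : Permutation′ n) → IsoVia σ (isBase M) (isBase M') →
       ∀ (k : ℕ) (a : Vec ℕ k) → coeffF (isBase M) k a ≡ coeffF (isBase M') k a)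
  -- unit: F(empty matroid) = 1
  × (∀ (k : ℕ) (a : Vec ℕ k) → coeffF emptyBases k a ≡ (if allZero a then 1 else 0))
  -- product: F(M₁ ⊕ M₂, x) = F(M₁, x) F(M₂, x)
  × (∀ {n₁ n₂} (M₁ : Matroid n₁) (M₂ : Matroid n₂) (k : ℕ) (a : Vec ℕ k) →
       coeffF (directSumBases (isBase M₁) (isBase M₂)) k a
         ≡ productCoeff (coeffF (isBase M₁) k) (coeffF (isBase M₂) k) a)
  -- counit: constant term of F(M, x) equals ε[M] (1 if E = ∅, else 0)
  × (∀ {n} (M : Matroid n) → coeffF (isBase M) 0 [] ≡ (if n ≡ᵇ 0 then 1 else 0))
  -- coproduct: F(M)(x, y) = Σ_{A ⊆ E} F(M|A)(x) F(M/A)(y)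
  × (∀ {n} (M : Matroid n) (k m : ℕ) (a : Vec ℕ k) (b : Vec ℕ m) →
       coeffF (isBase M) (k + m) (a ++ b)
         ≡ sum (map (λ A → coeffF (restrictBases (isBase M) A) k a
                             * coeffF (contractBases (isBase M) A) m b)
                    (allSubsets n)))
theorem3p1 =
  (λ M k a → coeffF-flatten M a) ,
  (λ M M′ σ iso k a → coeffF-iso σ iso k a) ,
  coeffF-emptyBases ,
  (λ M₁ M₂ → coeffF-directSum (isBase M₁) (isBase M₂)) ,
  coeffF-constantTerm ,
  (λ M k m a b → coeffF-coproduct M a b)
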